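{- Let $R$ be either $\mathbb{F}_q$ ($q$ a prime power) or $\mathbb{Z}_k$ ($k\ge2$), with elements listed in a fixed order $0=\omega_0,\dots,\omega_{|R|-1}$, $K=\{0,\dots,|R|-1\}$, and let $C,D$ be $R$-linear codes of length $n$. Then \[ \mathcal{C}\mathcal{J}^{\mathrm{av}}_{C,D}(x_{ij}\text{ with } i,j\in K)=\sum_{\eta} A_r^{C}A_s^{D}\,\frac{\prod_{i=0}^{|R|-1}\binom{s_i}{\eta_{\omega_0\omega_i},\dots,\eta_{\omega_{|R|-1}\omega_i}}}{\binom{n}{r_0,\dots,r_{|R|-1}}}\prod_{i,j=0}^{|R|-1}x_{ij}^{\eta_{\omega_i\omega_j}}, \] where the sum is over all bi-compositions $\eta=(\eta_{\alpha\beta})_{\alpha,\beta\in R}$ of $n$, and for each $\eta$ the compositions $r,s$ of $n$ are given by $r=\bigl(\sum_{\beta\in R}\eta_{\omega_0\beta},\dots,\sum_{\beta\in R}\eta_{\omega_{|R|-1}\beta}\bigr)$ and $s=\bigl(\sum_{\alpha\in R}\eta_{\alpha\omega_0},\dots,\sum_{\alpha\in R}\eta_{\alpha\omega_{|R|-1}}\bigr)$; here $\binom{a}{b_0,\dots,b_m}=\frac{a!}{b_0!\cdots b_m!}$.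
   Context: An $\mathbb{F}_q$-linear code of length $n$ is a subspace of $\mathbb{F}_q^n$; a $\mathbb{Z}_k$-linear code is an additive subgroup of $\mathbb{Z}_k^n$. A composition of $n$ is a vector $s=(s_0,\dots,s_{|R|-1})$ of non-negative integers summing to $n$; the composition of $u\in R^n$ is $(s_0(u),\dots,s_{|R|-1}(u))$ where $s_i(u)$ is the number of coordinates of $u$ equal to $\omega_i$. $A_s^C$ is the number of codewords of $C$ with composition $s$. A bi-composition of $n$ is a vector $(\eta_{\alpha\beta})_{\alpha,\beta\in R}$ of non-negative integers summing to $n$; for $u,v\in R^n$, $\eta_{\alpha\beta}(u,v)=\#\{i:(u_i,v_i)=(\alpha,\beta)\}$. The complete joint weight enumerator is $\mathcal{C}\mathcal{J}_{C,D}(x_{ij})=\sum_{u\in C,v\in D}\prod_{i,j}x_{ij}^{\eta_{\omega_i\omega_j}(u,v)}$. For $\sigma$ in the symmetric group $S_n$, $u^\sigma=(u_{\sigma(1)},\dots,u_{\sigma(n)})$ and $C^\sigma=\{u^\sigma:u\in C\}$. The average complete joint weight enumerator is $\mathcal{C}\mathcal{J}^{\mathrm{av}}_{C,D}(x_{ij})=\frac{1}{n!}\sum_{\sigma\in S_n}\mathcal{C}\mathcal{J}_{C^\sigma,D}(x_{ij})$. -}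

module Defs where

open import Data.Nat as ℕ using (ℕ; zero; suc; _≥_)
open import Data.Nat.DivMod using (_mod_)
import Data.Nat.DivMod as NDM
open import Data.Nat.Base using (_!)
open import Data.Fin as F using (Fin; toℕ)
open import Data.Fin.Properties using () renaming (_≟_ to _≟F_)
open import Data.Vec as V using (Vec; []; _∷_; lookup; tabulate)
open import Data.Vec.Properties using (≡-dec)
open import Data.List as L using (List; []; _∷_; filterᵇ; length; allFin; upTo; concatMap)
open import Data.Bool using (Bool; true; false; _∧_; not)
open import Data.Bool.ListAction using () renaming (all to allᵇ; any to anyᵇ)
open import Data.Product using (Σ; ∃; _×_; _,_)
open import Data.Sum using (_⊎_)
open import Data.Rational as Q using (ℚ; 0ℚ; 1ℚ)
open import Data.Integer using (+_)
open import Relation.Nullary using (¬_; does)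
open import Relation.Binary.PropositionalEquality using (_≡_; _≢_)
open import Algebra.Structures using (IsCommutativeRing)
open import Function.Definitions using (Bijective)

allVecs : {A : Set} → List A → (n : ℕ) → List (Vec A n)
allVecs xs zero    = [] ∷ []
allVecs xs (suc n) = concatMap (λ a → L.map (a ∷_) (allVecs xs n)) xs

Qsum : List ℚ → ℚ
Qsum = L.foldr Q._+_ 0ℚ

Qprod : List ℚ → ℚ
Qprod = L.foldr Q._*_ 1ℚ

_^Q_ : ℚ → ℕ → ℚ
x ^Q zero  = 1ℚ
x ^Q suc k = x Q.* (x ^Q k)

toQ : ℕ → ℚ
toQ a = (+ a) Q./ 1

-- a / d as a rational number (total: returns 0 when d = 0; never used with d = 0)
ratio : ℕ → ℕ → ℚ
ratio a zero    = 0ℚ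
ratio a (suc d) = (+ a) Q./ suc d

-- truncated natural division, total (d = 0 ↦ 0)
_div_ : ℕ → ℕ → ℕ
a div zero  = 0
a div suc d = a NDM./ suc d

multinomial : ∀ {k} → ℕ → Vec ℕ k → ℕ
multinomial a bs = (a !) div V.foldr _ ℕ._*_ 1 (V.map _! bs)

-- The alphabet R: a commutative ring whose carrier is Fin M with the
-- elements listed in the fixed order ω_i = i, and ω₀ = zero = 0_R.

record FinRing (M : ℕ) : Set where
  field
    _+R_ _*R_ : Fin (suc M) → Fin (suc M) → Fin (suc M)
    -R_       : Fin (suc M) → Fin (suc M)
    1R        : Fin (suc M)
    isCommRing : IsCommutativeRing _≡_ _+R_ _*R_ -R_ F.zero 1R

-- Case R = F_q: R is a field (finite, hence q = |R| is a prime power)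
IsFieldR : ∀ {M} → FinRing M → Set
IsFieldR R = (1R ≢ F.zero) × (∀ a → a ≢ F.zero → ∃ λ b → (a *R b) ≡ 1R)
  where open FinRing R

IsZkR : ∀ {M} → FinRing M → Set
IsZkR {M} R =
  (suc M ≥ 2) ×
  (∃ λ (φ : Fin (suc M) → Fin (suc M)) →
     Bijective _≡_ _≡_ φ ×
     (∀ a b → φ (a +R b) ≡ (toℕ (φ a) ℕ.+ toℕ (φ b)) mod (suc M)) ×
     (∀ a b → φ (a *R b) ≡ (toℕ (φ a) ℕ.* toℕ (φ b)) mod (suc M)))
  where open FinRing R

Word : ℕ → ℕ → Set
Word M n = Vec (Fin (suc M)) n

allWords : (M n : ℕ) → List (Word M n)
allWords M n = allVecs (allFin (suc M)) n

_≟W_ : ∀ {M n} → (u v : Word M n) → Bool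
u ≟W v = does (≡-dec _≟F_ u v)

Code : ℕ → ℕ → Set
Code M n = Word M n → Bool

-- R-linear code: an R-submodule of R^n
-- (for R = Z_k this is the same as an additive subgroup)
IsLinear : ∀ {M n} → FinRing M → Code M n → Set
IsLinear {M} {n} R C =
  (C (V.replicate n F.zero) ≡ true) ×
  (∀ u v → C u ≡ true → C v ≡ true → C (V.zipWith _+R_ u v) ≡ true) ×
  (∀ a u → C u ≡ true → C (V.map (a *R_) u) ≡ true)
  where open FinRing R

codewords : ∀ {M n} → Code M n → List (Word M n)
codewords {M} {n} C = filterᵇ C (allWords M n)

isInjectiveᵇ : ∀ {n} → Vec (Fin n) n → Bool
isInjectiveᵇ {n} σ =
  allᵇ (λ i → allᵇ (λ j → does (i ≟F j) Data.Bool.∨ not (does (lookup σ i ≟F lookup σ j)))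
                     (allFin n))
        (allFin n)

Sym : (n : ℕ) → List (Vec (Fin n) n)
Sym n = filterᵇ isInjectiveᵇ (allVecs (allFin n) n)

_^σ_ : ∀ {M n} → Word M n → Vec (Fin n) n → Word M n
u ^σ σ = tabulate (λ i → lookup u (lookup σ i))

permCode : ∀ {M n} → Code M n → Vec (Fin n) n → Code M n
permCode {M} {n} C σ w = anyᵇ (λ u → C u ∧ ((u ^σ σ) ≟W w)) (allWords M n)

countᵇ : ∀ {A : Set} {n} → (A → Bool) → Vec A n → ℕ
countᵇ p u = length (filterᵇ p (V.toList u))

composition : ∀ {M n} → Word M n → Vec ℕ (suc M)
composition u = tabulate (λ i → countᵇ (λ a → does (a ≟F i)) u)

A : ∀ {M n} → Code M n → Vec ℕ (suc M) → ℕ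
A C s = length (filterᵇ (λ u → does (≡-dec ℕ._≟_ (composition u) s)) (codewords C))

-- bi-compositions: η as an |R|×|R| table (η i j = η_{ω_i ω_j})
BiComp : ℕ → Set
BiComp M = Vec (Vec ℕ (suc M)) (suc M)

η_ : ∀ {M} → BiComp M → Fin (suc M) → Fin (suc M) → ℕ
η_ e i j = lookup (lookup e i) j

biComposition : ∀ {M n} → Word M n → Word M n → BiComp M
biComposition u v =
  tabulate (λ α → tabulate (λ β →
    countᵇ (λ p → does (Data.Product.proj₁ p ≟F α) ∧ does (Data.Product.proj₂ p ≟F β))
           (V.zip u v)))

total : ∀ {M} → BiComp M → ℕ
total e = V.sum (V.map V.sum e)

biCompositions : (M n : ℕ) → List (BiComp M)
biCompositions M n =
  filterᵇ (λ e → does (total e ℕ.≟ n)) (allVecs (allVecs (upTo (suc n)) (suc M)) (suc M))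

Vars : ℕ → Set
Vars M = Fin (suc M) → Fin (suc M) → ℚ

monomial : ∀ {M} → Vars M → BiComp M → ℚ
monomial {M} x e =
  Qprod (L.map (λ i → Qprod (L.map (λ j → x i j ^Q (η_ e i j)) (allFin (suc M)))) (allFin (suc M)))

CJ : ∀ {M n} → Code M n → Code M n → Vars M → ℚ
CJ C D x = Qsum (L.map (λ u → Qsum (L.map (λ v → monomial x (biComposition u v)) (codewords D)))
                       (codewords C))

CJav : ∀ {M n} → Code M n → Code M n → Vars M → ℚ
CJav {M} {n} C D x =
  ratio 1 (n !) Q.* Qsum (L.map (λ σ → CJ (permCode C σ) D x) (Sym n))

rowComp : ∀ {M} → BiComp M → Vec ℕ (suc M)
rowComp e = V.map V.sum e

colComp : ∀ {M} → BiComp M → Vec ℕ (suc M)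
colComp {M} e = tabulate (λ j → V.sum (tabulate (λ i → η_ e i j)))

column : ∀ {M} → BiComp M → Fin (suc M) → Vec ℕ (suc M)
column e i = tabulate (λ α → η_ e α i)

RHS : ∀ {M n} → Code M n → Code M n → Vars M → ℚ
RHS {M} {n} C D x =
  Qsum (L.map (λ e →
     let r = rowComp e ; s = colComp e in
     toQ (A C r ℕ.* A D s)
       Q.* ratio (L.foldr ℕ._*_ 1 (L.map (λ i → multinomial (lookup s i) (column e i)) (allFin (suc M))))
                 (multinomial n r)
       Q.* monomial x e)
   (biCompositions M n))

module Submission where

-- The identity is purely combinatorial: it holds for arbitrary codes C, D ⊆ Rⁿ.  With x^e the
-- monomial of a bi-composition e, s(u) the composition of u, and row e, col e
-- the row and column sums of e, reindexing C^σ by u ↦ u^σ gives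
--   CJav = Σ_{u ∈ C} Σ_{v ∈ D} (1/n!) Σ_{σ ∈ Sₙ} x^{η(u^σ, v)} ,
-- and each average over Sₙ is computed by two counts:
--   orbit count  #{σ : u^σ = w} = [s(u) = s(w)] · Π_c s_c(u)!, by counting
--                injective position sequences with falling factorials;
--   fibre count  #{w : η(w,v) = e} = [s(v) = col e] · Π_β multinomial(col_β e),
--                by induction on v, removing one entry of e at a time.
-- With n! = multinomial(n; s(u)) · Π_c s_c(u)!, the pair (u, v) contributes
-- [s(u) = row e] [s(v) = col e] · Π_β multinomial(col_β e) / multinomial(n; row e)
-- to the coefficient of x^e; summing over C × D gives A_{row e}^C A_{col e}^D.

open import Defs
open import Level using (0ℓ)
open import Data.Nat as ℕ using (ℕ; zero; suc; _+_; _*_; _∸_; _≤_; _<_; z≤n; s≤s; _!)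
import Data.Nat.Properties as ℕP
open import Data.Nat.Divisibility using (_∣_; ∣-refl; ∣-trans; *-monoʳ-∣)
open import Data.Nat.DivMod using (m/n*n≡m)
open import Data.Nat.Combinatorics using (k![n∸k]!∣n!)
open import Data.Fin as F using (Fin)
open import Data.Fin.Properties using () renaming (_≟_ to _≟F_)
import Data.Fin.Properties as FP
open import Data.Bool.Properties using (∨-identityʳ)
open import Data.Vec as V using (Vec; []; _∷_; lookup; tabulate)
open import Data.Vec.Properties using (≡-dec; lookup∘tabulate; tabulate∘lookup; tabulate-cong; lookup-map)
open import Data.List as L using (List; []; _∷_; _++_; filterᵇ; allFin; upTo; concatMap)
open import Data.List.Properties using (map-tabulate)
open import Data.List.Relation.Unary.Any using (here; there)
open import Data.List.Relation.Unary.AllPairs using (_∷_)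
open import Data.List.Relation.Unary.All.Properties using (All¬⇒¬Any)
open import Data.List.Relation.Unary.Unique.Propositional using (Unique)
open import Data.List.Relation.Unary.Unique.Propositional.Properties using (upTo⁺; allFin⁺)
open import Data.List.Membership.Propositional using (_∈_; _∉_)
open import Data.List.Membership.Propositional.Properties using (∈-allFin; ∈-upTo⁺)
open import Data.Bool using (Bool; true; false; _∧_; _∨_; not)
open import Data.Bool.ListAction using () renaming (all to allᵇ; any to anyᵇ)
open import Data.Empty using (⊥; ⊥-elim)
open import Data.Product using (_×_; _,_; proj₁; proj₂; ∃)
open import Data.Sum using (_⊎_; inj₁; inj₂)
open import Agda.Builtin.Int using (pos)
import Data.Integer as ℤ
import Data.Integer.Properties as ℤP
open import Data.Rational as ℚ using (ℚ; 1ℚ; toℚᵘ)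
import Data.Rational.Properties as ℚP
open import Data.Rational.Solver using (module +-*-Solver)
open import Data.Rational.Unnormalised as ℚᵘ using (mkℚᵘ; *≡*)
import Data.Rational.Unnormalised.Properties as ℚᵘP
open import Algebra.Bundles using (CommutativeSemiring; CommutativeRing)
open import Algebra.Structures using (IsCommutativeSemiring; IsCommutativeRing)
import Algebra.Properties.CommutativeSemigroup as CommSemigroupProps
open import Relation.Binary.Definitions using (DecidableEquality)
open import Relation.Binary.PropositionalEquality hiding ([_])
open import Relation.Nullary using (Dec; does; yes; no; ¬_)
open import Relation.Nullary.Decidable using (dec-true; dec-false; does-⇔; _×-dec_)
open import Function using (_∘_; _⇔_; mk⇔; Equivalence)

module Sums {S : Set} {_⊕_ _⊗_ : S → S → S} {0# 1# : S}
            (isCS : IsCommutativeSemiring _≡_ _⊕_ _⊗_ 0# 1#) where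
  open IsCommutativeSemiring isCS
    using (+-assoc; +-identityˡ; *-identityˡ; *-comm; distribˡ; zeroˡ; zeroʳ)
  private
    semiring : CommutativeSemiring 0ℓ 0ℓ
    semiring = record { isCommutativeSemiring = isCS }
  open CommSemigroupProps (CommutativeSemiring.+-commutativeSemigroup semiring)
    using (interchange)
  open CommSemigroupProps (CommutativeSemiring.*-commutativeSemigroup semiring)
    using () renaming (interchange to *-interchange)
  open ≡-Reasoning

  Σ : {X : Set} → List X → (X → S) → S
  Σ xs f = L.foldr _⊕_ 0# (L.map f xs)

  Π : {X : Set} → List X → (X → S) → S
  Π xs f = L.foldr _⊗_ 1# (L.map f xs)

  [_] : Bool → S
  [ true ]  = 1#
  [ false ] = 0#

  []-∧ : ∀ a b → [ a ∧ b ] ≡ [ a ] ⊗ [ b ]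
  []-∧ true  b = sym (*-identityˡ _)
  []-∧ false b = sym (zeroˡ _)

  []-cong : ∀ (b : Bool) {x y : S} → (b ≡ true → x ≡ y) → [ b ] ⊗ x ≡ [ b ] ⊗ y
  []-cong true  h = cong (1# ⊗_) (h refl)
  []-cong false h = trans (zeroˡ _) (sym (zeroˡ _))

  Σ-allFin-suc : ∀ m (f : Fin (suc m) → S) → Σ (allFin (suc m)) f ≡ f F.zero ⊕ Σ (allFin m) (f ∘ F.suc)
  Σ-allFin-suc m f = cong (λ ys → f F.zero ⊕ L.foldr _⊕_ 0# ys)
                          (trans (map-tabulate F.suc f) (sym (map-tabulate (λ i → i) (f ∘ F.suc))))

  Π-allFin-suc : ∀ m (f : Fin (suc m) → S) → Π (allFin (suc m)) f ≡ f F.zero ⊗ Π (allFin m) (f ∘ F.suc)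
  Π-allFin-suc m f = cong (λ ys → f F.zero ⊗ L.foldr _⊗_ 1# ys)
                          (trans (map-tabulate F.suc f) (sym (map-tabulate (λ i → i) (f ∘ F.suc))))

  module _ {X : Set} where
    Σ-cong : ∀ (xs : List X) {f g : X → S} → (∀ x → f x ≡ g x) → Σ xs f ≡ Σ xs g
    Σ-cong []       e = refl
    Σ-cong (x ∷ xs) e = cong₂ _⊕_ (e x) (Σ-cong xs e)

    Π-cong : ∀ (xs : List X) {f g : X → S} → (∀ x → f x ≡ g x) → Π xs f ≡ Π xs g
    Π-cong []       e = refl
    Π-cong (x ∷ xs) e = cong₂ _⊗_ (e x) (Π-cong xs e)

    Σ-++ : ∀ (xs ys : List X) (f : X → S) → Σ (xs ++ ys) f ≡ Σ xs f ⊕ Σ ys f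
    Σ-++ []       ys f = sym (+-identityˡ _)
    Σ-++ (x ∷ xs) ys f = trans (cong (f x ⊕_) (Σ-++ xs ys f)) (sym (+-assoc _ _ _))

    Σ-zero : ∀ (xs : List X) → Σ xs (λ _ → 0#) ≡ 0#
    Σ-zero []       = refl
    Σ-zero (x ∷ xs) = trans (cong (0# ⊕_) (Σ-zero xs)) (+-identityˡ _)

    Σ-⊕ : ∀ (xs : List X) (f g : X → S) → Σ xs (λ x → f x ⊕ g x) ≡ Σ xs f ⊕ Σ xs g
    Σ-⊕ []       f g = sym (+-identityˡ _)
    Σ-⊕ (x ∷ xs) f g =
      trans (cong ((f x ⊕ g x) ⊕_) (Σ-⊕ xs f g)) (interchange (f x) (g x) (Σ xs f) (Σ xs g))

    Σ-⊗ˡ : ∀ (c : S) (xs : List X) (f : X → S) → c ⊗ Σ xs f ≡ Σ xs (λ x → c ⊗ f x)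
    Σ-⊗ˡ c []       f = zeroʳ c
    Σ-⊗ˡ c (x ∷ xs) f = trans (distribˡ c _ _) (cong ((c ⊗ f x) ⊕_) (Σ-⊗ˡ c xs f))

    Σ-⊗ʳ : ∀ (c : S) (xs : List X) (f : X → S) → Σ xs f ⊗ c ≡ Σ xs (λ x → f x ⊗ c)
    Σ-⊗ʳ c xs f = trans (*-comm _ c) (trans (Σ-⊗ˡ c xs f) (Σ-cong xs (λ x → *-comm c (f x))))

    Σ-filter : ∀ (p : X → Bool) (xs : List X) (f : X → S) →
               Σ (filterᵇ p xs) f ≡ Σ xs (λ x → [ p x ] ⊗ f x)
    Σ-filter p []       f = refl
    Σ-filter p (x ∷ xs) f with p x
    ... | true  = cong₂ _⊕_ (sym (*-identityˡ _)) (Σ-filter p xs f)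
    ... | false = trans (Σ-filter p xs f) (sym (trans (cong (_⊕ rest) (zeroˡ (f x))) (+-identityˡ rest)))
      where rest = Σ xs (λ x → [ p x ] ⊗ f x)

    Σ-filter-cong : ∀ (p : X → Bool) (xs : List X) {f g : X → S} →
                    (∀ x → p x ≡ true → f x ≡ g x) → Σ (filterᵇ p xs) f ≡ Σ (filterᵇ p xs) g
    Σ-filter-cong p xs {f} {g} h = begin
      Σ (filterᵇ p xs) f          ≡⟨ Σ-filter p xs f ⟩
      Σ xs (λ x → [ p x ] ⊗ f x) ≡⟨ Σ-cong xs (λ x → []-cong (p x) (h x)) ⟩
      Σ xs (λ x → [ p x ] ⊗ g x) ≡⟨ Σ-filter p xs g ⟨
      Σ (filterᵇ p xs) g          ∎

    Π-one : ∀ (xs : List X) → Π xs (λ _ → 1#) ≡ 1#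
    Π-one []       = refl
    Π-one (x ∷ xs) = trans (cong (1# ⊗_) (Π-one xs)) (*-identityˡ 1#)

    Π-⊗ : ∀ (xs : List X) (f g : X → S) → Π xs f ⊗ Π xs g ≡ Π xs (λ x → f x ⊗ g x)
    Π-⊗ []       f g = *-identityˡ 1#
    Π-⊗ (x ∷ xs) f g =
      trans (*-interchange (f x) (Π xs f) (g x) (Π xs g)) (cong ((f x ⊗ g x) ⊗_) (Π-⊗ xs f g))

  module _ {X Y : Set} where
    Σ-map : ∀ (g : X → Y) (xs : List X) (f : Y → S) → Σ (L.map g xs) f ≡ Σ xs (f ∘ g)
    Σ-map g []       f = refl
    Σ-map g (x ∷ xs) f = cong (f (g x) ⊕_) (Σ-map g xs f)

    Σ-concatMap : ∀ (g : X → List Y) (xs : List X) (f : Y → S) →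
                  Σ (concatMap g xs) f ≡ Σ xs (λ x → Σ (g x) f)
    Σ-concatMap g []       f = refl
    Σ-concatMap g (x ∷ xs) f =
      trans (Σ-++ (g x) (concatMap g xs) f) (cong (Σ (g x) f ⊕_) (Σ-concatMap g xs f))

    Σ-swap : ∀ (xs : List X) (ys : List Y) (f : X → Y → S) →
             Σ xs (λ x → Σ ys (f x)) ≡ Σ ys (λ y → Σ xs (λ x → f x y))
    Σ-swap []       ys f = sym (Σ-zero ys)
    Σ-swap (x ∷ xs) ys f = trans (cong (Σ ys (f x) ⊕_) (Σ-swap xs ys f)) (sym (Σ-⊕ ys (f x) _))

  Σ-pick : ∀ {X : Set} (_≟_ : DecidableEquality X) (a : X) (xs : List X) (f : X → S) →
           Σ xs (λ x → [ does (a ≟ x) ]) ≡ 1# →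
           Σ xs (λ x → [ does (a ≟ x) ] ⊗ f x) ≡ f a
  Σ-pick _≟_ a xs f once = begin
    Σ xs (λ x → [ does (a ≟ x) ] ⊗ f x) ≡⟨ Σ-cong xs at-a ⟩
    Σ xs (λ x → [ does (a ≟ x) ] ⊗ f a) ≡⟨ Σ-⊗ʳ (f a) xs _ ⟨
    Σ xs (λ x → [ does (a ≟ x) ]) ⊗ f a ≡⟨ cong (_⊗ f a) once ⟩
    1# ⊗ f a                             ≡⟨ *-identityˡ _ ⟩
    f a                                  ∎
    where
    at-a : ∀ x → [ does (a ≟ x) ] ⊗ f x ≡ [ does (a ≟ x) ] ⊗ f a
    at-a x with a ≟ x
    ... | yes refl = refl
    ... | no _     = trans (zeroˡ _) (sym (zeroˡ _))

  Σ-bijection : ∀ {X : Set} (_≟_ : DecidableEquality X) (xs : List X) →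
                (∀ a → Σ xs (λ x → [ does (a ≟ x) ]) ≡ 1#) →
                (f g : X → X) → (∀ x y → (f x ≡ y) ⇔ (g y ≡ x)) →
                ∀ (h : X → S) → Σ xs h ≡ Σ xs (h ∘ f)
  Σ-bijection _≟_ xs once f g f⇔g h = begin
    Σ xs h
      ≡⟨ Σ-cong xs (λ y → sym (trans (cong (_⊗ h y) (preimage y)) (*-identityˡ (h y)))) ⟩
    Σ xs (λ y → Σ xs (λ x → [ does (f x ≟ y) ]) ⊗ h y)
      ≡⟨ Σ-cong xs (λ y → Σ-⊗ʳ (h y) xs _) ⟩
    Σ xs (λ y → Σ xs (λ x → [ does (f x ≟ y) ] ⊗ h y))
      ≡⟨ Σ-swap xs xs _ ⟩
    Σ xs (λ x → Σ xs (λ y → [ does (f x ≟ y) ] ⊗ h y))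
      ≡⟨ Σ-cong xs (λ x → Σ-pick _≟_ (f x) xs h (once (f x))) ⟩
    Σ xs (h ∘ f) ∎
    where
    -- every y has exactly one preimage under f, namely g y
    preimage : ∀ y → Σ xs (λ x → [ does (f x ≟ y) ]) ≡ 1#
    preimage y = trans (Σ-cong xs (λ x → cong [_] (does-⇔ (f⇔g x y) (f x ≟ y) (g y ≟ x)))) (once (g y))

module ℕΣ = Sums ℕP.+-*-isCommutativeSemiring
open ℕΣ

OccursOnce : {X : Set} → DecidableEquality X → X → List X → Set
OccursOnce _≟_ a xs = Σ xs (λ x → [ does (a ≟ x) ]) ≡ 1

length-filter : ∀ {X : Set} (p : X → Bool) (xs : List X) →
                L.length (filterᵇ p xs) ≡ Σ xs (λ x → [ p x ])
length-filter p []       = refl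
length-filter p (x ∷ xs) with p x
... | true  = cong suc (length-filter p xs)
... | false = length-filter p xs

module _ {X : Set} (_≟_ : DecidableEquality X) where

  count-absent : ∀ a (xs : List X) → a ∉ xs → Σ xs (λ x → [ does (a ≟ x) ]) ≡ 0
  count-absent a []       _  = refl
  count-absent a (x ∷ xs) a∉ with a ≟ x
  ... | yes refl = ⊥-elim (a∉ (here refl))
  ... | no _     = count-absent a xs (a∉ ∘ there)

  unique-once : ∀ {a} {xs : List X} → Unique xs → a ∈ xs → OccursOnce _≟_ a xs
  unique-once {a} {x ∷ xs} (x∉ ∷ _) (here refl) with a ≟ a
  ... | yes _ = cong suc (count-absent a xs (All¬⇒¬Any x∉))
  ... | no a≢a = ⊥-elim (a≢a refl)
  unique-once {a} {x ∷ xs} (x∉ ∷ u) (there a∈) with a ≟ x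
  ... | yes refl = ⊥-elim (All¬⇒¬Any x∉ a∈)
  ... | no _     = unique-once u a∈

  Π-scale : ∀ c (xs : List X) (f g : X → ℕ) (m : ℕ) → OccursOnce _≟_ c xs →
            (∀ x → c ≢ x → f x ≡ g x) → f c ≡ m * g c → Π xs f ≡ m * Π xs g
  Π-scale c []       f g m ()   off at
  Π-scale c (x ∷ xs) f g m once off at with c ≟ x
  ... | yes refl = begin
    f c * Π xs f       ≡⟨ cong₂ _*_ at (Π-agree xs (ℕP.suc-injective once)) ⟩
    (m * g c) * Π xs g ≡⟨ ℕP.*-assoc m (g c) _ ⟩
    m * (g c * Π xs g) ∎
    where
    open ≡-Reasoning
    -- c does not occur in ys (its count is 0), so f and g agree along ys
    Π-agree : ∀ ys → Σ ys (λ y → [ does (c ≟ y) ]) ≡ 0 → Π ys f ≡ Π ys g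
    Π-agree []       _    = refl
    Π-agree (y ∷ ys) none with c ≟ y
    ... | no c≢y = cong₂ _*_ (off y c≢y) (Π-agree ys none)
  ... | no c≢x = begin
    f x * Π xs f       ≡⟨ cong₂ _*_ (off x c≢x) (Π-scale c xs f g m once off at) ⟩
    g x * (m * Π xs g) ≡⟨ x∙yz≈y∙xz (g x) m _ ⟩
    m * (g x * Π xs g) ∎
    where
    open ≡-Reasoning
    open CommSemigroupProps ℕP.*-commutativeSemigroup using (x∙yz≈y∙xz)

allFin-once : ∀ m (i : Fin m) → OccursOnce _≟F_ i (allFin m)
allFin-once m i = unique-once _≟F_ (allFin⁺ m) (∈-allFin i)

-- every y ≤ n occurs once in upTo (suc n) = [0, …, n]
upTo-once : ∀ n y → y ≤ n → OccursOnce ℕ._≟_ y (upTo (suc n))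
upTo-once n y y≤n = unique-once ℕ._≟_ (upTo⁺ (suc n)) (∈-upTo⁺ (s≤s y≤n))

allVecs-once : ∀ {X : Set} (_≟_ : DecidableEquality X) (xs : List X) n (y : Vec X n) →
               (∀ i → OccursOnce _≟_ (lookup y i) xs) → OccursOnce (≡-dec _≟_) y (allVecs xs n)
allVecs-once _≟_ xs zero    []       _    = refl
allVecs-once _≟_ xs (suc n) (y ∷ ys) once = begin
  Σ (concatMap (λ a → L.map (a ∷_) (allVecs xs n)) xs) (λ v → [ does (≡-dec _≟_ (y ∷ ys) v) ])
    ≡⟨ Σ-concatMap (λ a → L.map (a ∷_) (allVecs xs n)) xs _ ⟩
  Σ xs (λ a → Σ (L.map (a ∷_) (allVecs xs n)) (λ v → [ does (≡-dec _≟_ (y ∷ ys) v) ]))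
    ≡⟨ Σ-cong xs (λ a → Σ-map (a ∷_) (allVecs xs n) _) ⟩
  Σ xs (λ a → Σ (allVecs xs n) (λ v → [ does (y ≟ a) ∧ does (≡-dec _≟_ ys v) ]))
    ≡⟨ Σ-cong xs (λ a → Σ-cong (allVecs xs n) (λ v → []-∧ (does (y ≟ a)) _)) ⟩
  Σ xs (λ a → Σ (allVecs xs n) (λ v → [ does (y ≟ a) ] * [ does (≡-dec _≟_ ys v) ]))
    ≡⟨ Σ-cong xs (λ a → Σ-⊗ˡ [ does (y ≟ a) ] (allVecs xs n) _) ⟨
  Σ xs (λ a → [ does (y ≟ a) ] * Σ (allVecs xs n) (λ v → [ does (≡-dec _≟_ ys v) ]))
    ≡⟨ Σ-cong xs (λ a → cong ([ does (y ≟ a) ] *_) (allVecs-once _≟_ xs n ys (once ∘ F.suc))) ⟩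
  Σ xs (λ a → [ does (y ≟ a) ] * 1)
    ≡⟨ Σ-cong xs (λ a → ℕP.*-identityʳ _) ⟩
  Σ xs (λ a → [ does (y ≟ a) ])
    ≡⟨ once F.zero ⟩
  1 ∎
  where open ≡-Reasoning

once⇒∈ : ∀ {X : Set} (_≟_ : DecidableEquality X) {a} (xs : List X) → OccursOnce _≟_ a xs → a ∈ xs
once⇒∈ _≟_ {a} (x ∷ xs) once with a ≟ x
... | yes refl = here refl
... | no  _    = there (once⇒∈ _≟_ xs once)

allWords-once : ∀ M n (w : Word M n) → OccursOnce (≡-dec _≟F_) w (allWords M n)
allWords-once M n w = allVecs-once _≟F_ (allFin (suc M)) n w (λ i → allFin-once (suc M) (lookup w i))

module ℚΣ = Sums (IsCommutativeRing.isCommutativeSemiring ℚP.+-*-isCommutativeRing)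
open ℚΣ using () renaming (Σ to Σℚ; [_] to ⟦_⟧)

private
  toQ-unnormalised : ∀ a → toℚᵘ (toQ a) ℚᵘ.≃ mkℚᵘ (pos a) 0
  toQ-unnormalised a = ℚP.toℚᵘ-fromℚᵘ (mkℚᵘ (pos a) 0)

toQ-+ : ∀ a b → toQ (a + b) ≡ toQ a ℚ.+ toQ b
toQ-+ a b = ℚP.toℚᵘ-injective (ℚᵘP.≃-trans (toQ-unnormalised (a + b)) (ℚᵘP.≃-sym
  (ℚᵘP.≃-trans (ℚP.toℚᵘ-homo-+ (toQ a) (toQ b))
  (ℚᵘP.≃-trans (ℚᵘP.+-cong (toQ-unnormalised a) (toQ-unnormalised b)) (*≡* cross)))))
  where
  cross : (pos a ℤ.* pos 1 ℤ.+ pos b ℤ.* pos 1) ℤ.* pos 1 ≡ pos (a + b) ℤ.* pos (1 * 1)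
  cross = trans (ℤP.*-identityʳ _)
                (trans (cong₂ ℤ._+_ (ℤP.*-identityʳ (pos a)) (ℤP.*-identityʳ (pos b)))
                       (sym (ℤP.*-identityʳ _)))

toQ-* : ∀ a b → toQ (a * b) ≡ toQ a ℚ.* toQ b
toQ-* a b = ℚP.toℚᵘ-injective (ℚᵘP.≃-trans (toQ-unnormalised (a * b)) (ℚᵘP.≃-sym
  (ℚᵘP.≃-trans (ℚP.toℚᵘ-homo-* (toQ a) (toQ b))
  (ℚᵘP.≃-trans (ℚᵘP.*-cong (toQ-unnormalised a) (toQ-unnormalised b)) (*≡* cross)))))
  where
  cross : (pos a ℤ.* pos b) ℤ.* pos 1 ≡ pos (a * b) ℤ.* pos (1 * 1)
  cross = trans (ℤP.*-identityʳ _) (trans (sym (ℤP.pos-* a b)) (sym (ℤP.*-identityʳ _)))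

toQ-[] : ∀ b → toQ [ b ] ≡ ⟦ b ⟧
toQ-[] true  = refl
toQ-[] false = refl

toQ-count : ∀ {X : Set} (xs : List X) (p : X → Bool) →
            toQ (Σ xs (λ x → [ p x ])) ≡ Σℚ xs (λ x → ⟦ p x ⟧)
toQ-count []       p = refl
toQ-count (x ∷ xs) p = trans (toQ-+ [ p x ] _) (cong₂ ℚ._+_ (toQ-[] (p x)) (toQ-count xs p))

toQ-[]* : ∀ b m → toQ ([ b ] * m) ≡ ⟦ b ⟧ ℚ.* toQ m
toQ-[]* b m = trans (toQ-* [ b ] m) (cong (ℚ._* toQ m) (toQ-[] b))

ratio-solves : ∀ a d → .{{ℕ.NonZero d}} → ratio a d ℚ.* toQ d ≡ toQ a
ratio-solves a (suc d) = ℚP.toℚᵘ-injective (ℚᵘP.≃-trans (ℚP.toℚᵘ-homo-* (ratio a (suc d)) (toQ (suc d)))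
  (ℚᵘP.≃-trans (ℚᵘP.*-cong (ℚP.toℚᵘ-fromℚᵘ (mkℚᵘ (pos a) d)) (toQ-unnormalised (suc d)))
  (ℚᵘP.≃-trans (*≡* cross) (ℚᵘP.≃-sym (toQ-unnormalised a)))))
  where
  cross : (pos a ℤ.* pos (suc d)) ℤ.* pos 1 ≡ pos a ℤ.* pos (suc d * 1)
  cross = trans (ℤP.*-identityʳ _) (cong (λ z → pos a ℤ.* pos z) (sym (ℕP.*-identityʳ (suc d))))

ratio-unique : ∀ (q : ℚ) a d → .{{ℕ.NonZero d}} → q ℚ.* toQ d ≡ toQ a → q ≡ ratio a d
ratio-unique q a d@(suc _) qd≡a = begin
  q                                ≡⟨ cancel q ⟩
  (q ℚ.* c) ℚ.* ℚ.1/ c             ≡⟨ cong (ℚ._* ℚ.1/ c) (trans qd≡a (sym (ratio-solves a d))) ⟩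
  (ratio a d ℚ.* c) ℚ.* ℚ.1/ c     ≡⟨ cancel (ratio a d) ⟨
  ratio a d                        ∎
  where
  open ≡-Reasoning
  c = toQ d
  instance
    c≢0 : ℚ.NonZero c
    c≢0 = ℚP.pos⇒nonZero c {{ℚP.normalize-pos d 1}}
  cancel : ∀ p → p ≡ (p ℚ.* c) ℚ.* ℚ.1/ c
  cancel p = sym (trans (ℚP.*-assoc p c _) (trans (cong (p ℚ.*_) (ℚP.*-inverseʳ c)) (ℚP.*-identityʳ p)))

vec-ext : ∀ {X : Set} {m} (xs ys : Vec X m) → (∀ i → lookup xs i ≡ lookup ys i) → xs ≡ ys
vec-ext xs ys h = trans (sym (tabulate∘lookup xs)) (trans (tabulate-cong h) (tabulate∘lookup ys))

Vsum-lookup : ∀ {m} (xs : Vec ℕ m) → V.sum xs ≡ Σ (allFin m) (lookup xs)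
Vsum-lookup []       = refl
Vsum-lookup {suc m} (x ∷ xs) = trans (cong (x +_) (Vsum-lookup xs)) (sym (Σ-allFin-suc m (lookup (x ∷ xs))))

Vsum-tabulate : ∀ m (f : Fin m → ℕ) → V.sum (tabulate f) ≡ Σ (allFin m) f
Vsum-tabulate m f = trans (Vsum-lookup (tabulate f)) (Σ-cong (allFin m) (lookup∘tabulate f))

Σ-toList : ∀ {X : Set} {k} (u : Vec X k) (f : X → ℕ) → Σ (V.toList u) f ≡ Σ (allFin k) (f ∘ lookup u)
Σ-toList []       f = refl
Σ-toList {k = suc k} (x ∷ u) f = trans (cong (f x +_) (Σ-toList u f)) (sym (Σ-allFin-suc k (f ∘ lookup (x ∷ u))))

factorials : ∀ {m} → Vec ℕ m → ℕ
factorials bs = V.foldr _ _*_ 1 (V.map _! bs)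

factorials-lookup : ∀ {m} (bs : Vec ℕ m) → factorials bs ≡ Π (allFin m) (λ i → lookup bs i !)
factorials-lookup []       = refl
factorials-lookup {suc m} (b ∷ bs) =
  trans (cong (b ! *_) (factorials-lookup bs)) (sym (Π-allFin-suc m (λ i → lookup (b ∷ bs) i !)))

factorials-nonZero : ∀ {m} (bs : Vec ℕ m) → ℕ.NonZero (factorials bs)
factorials-nonZero []       = _
factorials-nonZero (b ∷ bs) = ℕP.m*n≢0 (b !) (factorials bs) {{ℕP._!≢0 b}} {{factorials-nonZero bs}}

factorials-∣ : ∀ {m} (bs : Vec ℕ m) → factorials bs ∣ V.sum bs !
factorials-∣ []       = ∣-refl
factorials-∣ (b ∷ bs) = ∣-trans (*-monoʳ-∣ (b !) (factorials-∣ bs))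
  (subst (λ z → b ! * z ! ∣ (b + V.sum bs) !) (ℕP.m+n∸m≡n b (V.sum bs))
         (k![n∸k]!∣n! (ℕP.m≤m+n b (V.sum bs))))

multinomial-exact : ∀ {m} (bs : Vec ℕ m) →
                    multinomial (V.sum bs) bs * Π (allFin m) (λ i → lookup bs i !) ≡ V.sum bs !
multinomial-exact bs = trans (cong (multinomial (V.sum bs) bs *_) (sym (factorials-lookup bs)))
                             (div-exact (V.sum bs !) (factorials bs) {{factorials-nonZero bs}} (factorials-∣ bs))
  where
  div-exact : ∀ a d → .{{ℕ.NonZero d}} → d ∣ a → (a div d) * d ≡ a
  div-exact a (suc d) = m/n*n≡m

bool-ext : ∀ {a b : Bool} → (a ≡ true → b ≡ true) → (b ≡ true → a ≡ true) → a ≡ b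
bool-ext {true}  {true}  _ _ = refl
bool-ext {true}  {false} f _ = sym (f refl)
bool-ext {false} {true}  _ g = g refl
bool-ext {false} {false} _ _ = refl

∧-true : ∀ {a b} → a ∧ b ≡ true → a ≡ true × b ≡ true
∧-true {true} {true} _ = refl , refl

∨-false : ∀ {a b} → a ∨ b ≡ false → a ≡ false × b ≡ false
∨-false {false} {false} _ = refl , refl

not-true : ∀ {a} → not a ≡ true → a ≡ false
not-true {false} _ = refl

true≢false : ∀ {a} → a ≡ true → a ≡ false → ⊥
true≢false refl ()

from-does : ∀ {P : Set} (d : Dec P) → does d ≡ true → P
from-does (yes p) _ = p

allᵇ-true : ∀ {X : Set} (p : X → Bool) (xs : List X) → allᵇ p xs ≡ true →
            ∀ {x} → x ∈ xs → p x ≡ true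
allᵇ-true p (y ∷ xs) h (here refl) = proj₁ (∧-true h)
allᵇ-true p (y ∷ xs) h (there x∈) = allᵇ-true p xs (proj₂ (∧-true h)) x∈

allᵇ-intro : ∀ {X : Set} (p : X → Bool) (xs : List X) → (∀ x → p x ≡ true) → allᵇ p xs ≡ true
allᵇ-intro p []       h = refl
allᵇ-intro p (x ∷ xs) h rewrite h x = allᵇ-intro p xs h

anyᵇ-witness : ∀ {X : Set} (p : X → Bool) (xs : List X) → anyᵇ p xs ≡ true → ∃ λ x → p x ≡ true
anyᵇ-witness p (x ∷ xs) h with p x in px
... | true  = x , px
... | false = anyᵇ-witness p xs h

anyᵇ-intro : ∀ {X : Set} (p : X → Bool) {x} (xs : List X) → x ∈ xs → p x ≡ true → anyᵇ p xs ≡ true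
anyᵇ-intro p (y ∷ xs) (here refl) px rewrite px = refl
anyᵇ-intro p (y ∷ xs) (there x∈) px with p y
... | true  = refl
... | false = anyᵇ-intro p xs x∈ px

module _ {n : ℕ} where

  InjectiveSeq : ∀ {k} → Vec (Fin n) k → Set
  InjectiveSeq σ = ∀ i j → lookup σ i ≡ lookup σ j → i ≡ j

  _∪｛_｝ : (Fin n → Bool) → Fin n → (Fin n → Bool)
  (S ∪｛ a ｝) j = S j ∨ does (j ≟F a)

  -- Unlike
  -- isInjectiveᵇ this test is defined by recursion on σ, which makes the
  -- number of fresh sequences computable by induction.
  fresh : ∀ {k} → (Fin n → Bool) → Vec (Fin n) k → Bool
  fresh S []      = true
  fresh S (a ∷ σ) = not (S a) ∧ fresh (S ∪｛ a ｝) σ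

  fresh-sound : ∀ {k} (S : Fin n → Bool) (σ : Vec (Fin n) k) → fresh S σ ≡ true →
                (∀ i → S (lookup σ i) ≡ false) × InjectiveSeq σ
  fresh-sound S []      _  = (λ ()) , (λ ())
  fresh-sound S (a ∷ σ) ok with ∧-true ok
  ... | a∉S , rest with fresh-sound (S ∪｛ a ｝) σ rest
  ... | avoids , inj = avoids′ , inj′
    where
    ≢a : ∀ j → lookup σ j ≢ a
    ≢a j e = true≢false (dec-true (lookup σ j ≟F a) e) (proj₂ (∨-false (avoids j)))
    avoids′ : ∀ i → S (lookup (a ∷ σ) i) ≡ false
    avoids′ F.zero    = not-true a∉S
    avoids′ (F.suc i) = proj₁ (∨-false (avoids i))
    inj′ : InjectiveSeq (a ∷ σ)
    inj′ F.zero    F.zero    _ = refl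
    inj′ F.zero    (F.suc j) e = ⊥-elim (≢a j (sym e))
    inj′ (F.suc i) F.zero    e = ⊥-elim (≢a i e)
    inj′ (F.suc i) (F.suc j) e = cong F.suc (inj i j e)

  fresh-complete : ∀ {k} (S : Fin n → Bool) (σ : Vec (Fin n) k) →
                   (∀ i → S (lookup σ i) ≡ false) → InjectiveSeq σ → fresh S σ ≡ true
  fresh-complete S []      _      _   = refl
  fresh-complete S (a ∷ σ) avoids inj rewrite avoids F.zero =
    fresh-complete (S ∪｛ a ｝) σ avoids′ (λ i j e → FP.suc-injective (inj (F.suc i) (F.suc j) e))
    where
    avoids′ : ∀ i → (S ∪｛ a ｝) (lookup σ i) ≡ false
    avoids′ i rewrite avoids (F.suc i) =
      dec-false (lookup σ i ≟F a) (λ e → FP.0≢1+n (inj F.zero (F.suc i) (sym e)))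

  isInjectiveᵇ-sound : (σ : Vec (Fin n) n) → isInjectiveᵇ σ ≡ true → InjectiveSeq σ
  isInjectiveᵇ-sound σ ok i j e
    with allᵇ-true _ (allFin n) (allᵇ-true _ (allFin n) ok (∈-allFin i)) (∈-allFin j)
  ... | i,j-ok with i ≟F j
  ... | yes i≡j = i≡j
  ... | no  _   rewrite dec-true (lookup σ i ≟F lookup σ j) e = ⊥-elim (true≢false i,j-ok refl)

  isInjectiveᵇ-complete : (σ : Vec (Fin n) n) → InjectiveSeq σ → isInjectiveᵇ σ ≡ true
  isInjectiveᵇ-complete σ inj = allᵇ-intro _ (allFin n) (λ i → allᵇ-intro _ (allFin n) (pair-ok i))
    where
    pair-ok : ∀ i j → (does (i ≟F j) ∨ not (does (lookup σ i ≟F lookup σ j))) ≡ true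
    pair-ok i j with i ≟F j
    ... | yes _ = refl
    ... | no i≢j rewrite dec-false (lookup σ i ≟F lookup σ j) (i≢j ∘ inj i j) = refl

  isInjectiveᵇ≡fresh : (σ : Vec (Fin n) n) → isInjectiveᵇ σ ≡ fresh (λ _ → false) σ
  isInjectiveᵇ≡fresh σ =
    bool-ext (λ ok → fresh-complete _ σ (λ _ → refl) (isInjectiveᵇ-sound σ ok))
             (λ ok → isInjectiveᵇ-complete σ (proj₂ (fresh-sound _ σ ok)))

injective⇒onto : ∀ {n} (f : Fin n → Fin n) → (∀ i j → f i ≡ f j → i ≡ j) →
                 ∀ j → ∃ λ i → f i ≡ j
injective⇒onto {suc m} f inj j with FP.any? (λ i → f i ≟F j)
... | yes hit  = hit
... | no  miss = ⊥-elim (ℕP.<-irrefl refl (FP.injective⇒≤ squeeze-injective))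
  where
  -- f misses j, so it factors injectively through Fin (suc m) ∖ {j} ≅ Fin m
  f≢j : ∀ i → j ≢ f i
  f≢j i e = miss (i , sym e)
  squeeze : Fin (suc m) → Fin m
  squeeze i = F.punchOut (f≢j i)
  squeeze-injective : ∀ {i i′} → squeeze i ≡ squeeze i′ → i ≡ i′
  squeeze-injective e = inj _ _ (FP.punchOut-injective (f≢j _) (f≢j _) e)

_≟V_ : ∀ {m} → DecidableEquality (Vec ℕ m)
_≟V_ = ≡-dec ℕ._≟_

occ : ∀ {M k} → Word M k → Fin (suc M) → ℕ
occ w c = Σ (V.toList w) (λ a → [ does (a ≟F c) ])

composition-lookup : ∀ {M k} (w : Word M k) c → lookup (composition w) c ≡ occ w c
composition-lookup w c = trans (lookup∘tabulate (λ i → countᵇ (λ a → does (a ≟F i)) w) c)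
                               (length-filter (λ a → does (a ≟F c)) (V.toList w))

composition-ext : ∀ {M k l} (w : Word M k) (w′ : Word M l) →
                  (∀ c → occ w c ≡ occ w′ c) → composition w ≡ composition w′
composition-ext w w′ h = vec-ext _ _ (λ c →
  trans (composition-lookup w c) (trans (h c) (sym (composition-lookup w′ c))))

occ-total : ∀ {M k} (w : Word M k) → Σ (allFin (suc M)) (occ w) ≡ k
occ-total {M} {k} w = begin
  Σ (allFin (suc M)) (λ c → Σ (V.toList w) (λ a → [ does (a ≟F c) ]))
    ≡⟨ Σ-swap (allFin (suc M)) (V.toList w) _ ⟩
  Σ (V.toList w) (λ a → Σ (allFin (suc M)) (λ c → [ does (a ≟F c) ]))
    ≡⟨ Σ-cong (V.toList w) (allFin-once (suc M)) ⟩
  Σ (V.toList w) (λ _ → 1)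
    ≡⟨ length-toList w ⟩
  k ∎
  where
  open ≡-Reasoning
  length-toList : ∀ {k} (w : Word M k) → Σ (V.toList w) (λ _ → 1) ≡ k
  length-toList []      = refl
  length-toList (_ ∷ w) = cong suc (length-toList w)

Σ-≤-≡ : ∀ {X : Set} (xs : List X) (f g : X → ℕ) → (∀ x → g x ≤ f x) → Σ xs f ≡ Σ xs g →
        ∀ {x} → x ∈ xs → f x ≡ g x
Σ-≤-≡ (y ∷ xs) f g g≤f same = agree
  where
  Σ-mono : ∀ ys → Σ ys g ≤ Σ ys f
  Σ-mono []       = z≤n
  Σ-mono (y ∷ ys) = ℕP.+-mono-≤ (g≤f y) (Σ-mono ys)
  head-≤ : f y ≤ g y
  head-≤ = ℕP.+-cancelʳ-≤ (Σ xs f) (f y) (g y)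
             (ℕP.≤-trans (ℕP.≤-reflexive same) (ℕP.+-monoʳ-≤ (g y) (Σ-mono xs)))
  head-≡ : f y ≡ g y
  head-≡ = ℕP.≤-antisym head-≤ (g≤f y)
  agree : ∀ {x} → x ∈ y ∷ xs → f x ≡ g x
  agree (here refl) = head-≡
  agree (there x∈)  = Σ-≤-≡ xs f g g≤f
    (ℕP.+-cancelˡ-≡ (f y) (Σ xs f) (Σ xs g) (trans same (cong (_+ Σ xs g) (sym head-≡)))) x∈

composition-≢ : ∀ {M k} (u w : Word M k) → composition u ≢ composition w →
                ∃ λ c → occ u c < occ w c
composition-≢ {M} u w u≢w
  with FP.¬∀⟶∃¬ (suc M) (λ c → occ w c ≤ occ u c) (λ c → occ w c ℕ.≤? occ u c) all-≤
  where
  all-≤ : ¬ (∀ c → occ w c ≤ occ u c)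
  all-≤ w≤u = u≢w (composition-ext u w (λ c →
    Σ-≤-≡ (allFin (suc M)) (occ u) (occ w) w≤u (trans (occ-total u) (sym (occ-total w))) (∈-allFin c)))
... | c , w≰u = c , ℕP.≰⇒> w≰u

-- The orbit count  #{σ ∈ Sₙ : u^σ = w} = [s(u) = s(w)] · Π_c s_c(u)!

-- falling r t = r (r - 1) ⋯ (r - t + 1), the number of injective sequences
-- of length t drawn from r objects
falling : ℕ → ℕ → ℕ
falling r zero    = 1
falling r (suc t) = r * falling (r ∸ 1) t

falling-refl : ∀ r → falling r r ≡ r !
falling-refl zero    = refl
falling-refl (suc r) = cong (suc r *_) (falling-refl r)

falling-zero : ∀ r t → r < t → falling r t ≡ 0
falling-zero zero    (suc t) _         = refl
falling-zero (suc r) (suc t) (s≤s r<t) = trans (cong (suc r *_) (falling-zero r t r<t)) (ℕP.*-zeroʳ (suc r))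

δ : ∀ {m} → Fin m → Fin m → ℕ
δ c c′ = [ does (c ≟F c′) ]

falling-step : ∀ {m} (c : Fin m) (r t : Fin m → ℕ) →
               r c * Π (allFin m) (λ c′ → falling (r c′ ∸ δ c c′) (t c′)) ≡
               Π (allFin m) (λ c′ → falling (r c′) (δ c c′ + t c′))
falling-step {m} c r t = sym (Π-scale _≟F_ c (allFin m) _ _ (r c) (allFin-once m c) off at)
  where
  off : ∀ c′ → c ≢ c′ → falling (r c′) (δ c c′ + t c′) ≡ falling (r c′ ∸ δ c c′) (t c′)
  off c′ c≢c′ rewrite dec-false (c ≟F c′) c≢c′ = refl
  at : falling (r c) (δ c c + t c) ≡ r c * falling (r c ∸ δ c c) (t c)
  at rewrite dec-true (c ≟F c) refl = refl

module OrbitCount {M n : ℕ} (u : Word M n) where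

  readAt : ∀ {k} → Vec (Fin n) k → Word M k
  readAt σ = tabulate (λ i → lookup u (lookup σ i))

  avail : (Fin n → Bool) → Fin (suc M) → ℕ
  avail S c = Σ (allFin n) (λ j → [ not (S j) ∧ does (lookup u j ≟F c) ])

  readings : ∀ {k} → (Fin n → Bool) → Word M k → ℕ
  readings {k} S w = Σ (allVecs (allFin n) k) (λ σ → [ fresh S σ ∧ (readAt σ ≟W w) ])

  -- choosing the first position a of a reading of c ∷ w
  readings-step : ∀ {k} S c (w : Word M k) →
                  readings S (c ∷ w) ≡
                  Σ (allFin n) (λ a → [ not (S a) ∧ does (lookup u a ≟F c) ] * readings (S ∪｛ a ｝) w)
  readings-step {k} S c w = begin
    readings S (c ∷ w)
      ≡⟨ Σ-concatMap (λ a → L.map (a ∷_) (allVecs (allFin n) k)) (allFin n) _ ⟩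
    Σ (allFin n) (λ a → Σ (L.map (a ∷_) (allVecs (allFin n) k)) (λ σ →
        [ fresh S σ ∧ (readAt σ ≟W (c ∷ w)) ]))
      ≡⟨ Σ-cong (allFin n) (λ a → Σ-map (a ∷_) (allVecs (allFin n) k) _) ⟩
    Σ (allFin n) (λ a → Σ (allVecs (allFin n) k) (λ σ →
        [ (not (S a) ∧ fresh (S ∪｛ a ｝) σ) ∧ (does (lookup u a ≟F c) ∧ (readAt σ ≟W w)) ]))
      ≡⟨ Σ-cong (allFin n) (λ a → Σ-cong (allVecs (allFin n) k) (λ σ → regroup (not (S a)) _ _ _)) ⟩
    Σ (allFin n) (λ a → Σ (allVecs (allFin n) k) (λ σ →
        [ not (S a) ∧ does (lookup u a ≟F c) ] * [ fresh (S ∪｛ a ｝) σ ∧ (readAt σ ≟W w) ]))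
      ≡⟨ Σ-cong (allFin n) (λ a → Σ-⊗ˡ [ not (S a) ∧ does (lookup u a ≟F c) ] (allVecs (allFin n) k) _) ⟨
    Σ (allFin n) (λ a → [ not (S a) ∧ does (lookup u a ≟F c) ] * readings (S ∪｛ a ｝) w) ∎
    where
    open ≡-Reasoning
    regroup : ∀ p q r s → [ (p ∧ q) ∧ (r ∧ s) ] ≡ [ p ∧ r ] * [ q ∧ s ]
    regroup true  true  true  true  = refl
    regroup true  true  true  false = refl
    regroup true  false true  s     = refl
    regroup true  true  false s     = refl
    regroup true  false false s     = refl
    regroup false q     r     s     = refl

  avail-step : ∀ S a c → S a ≡ false → lookup u a ≡ c →
               ∀ c′ → avail (S ∪｛ a ｝) c′ ≡ avail S c′ ∸ δ c c′
  avail-step S a c a∉S ua≡c c′ = sym (begin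
    avail S c′ ∸ δ c c′
      ≡⟨ cong (_∸ δ c c′) (Σ-cong (allFin n) split) ⟩
    Σ (allFin n) (λ j → [ not ((S ∪｛ a ｝) j) ∧ does (lookup u j ≟F c′) ] + [ does (a ≟F j) ] * δ c c′)
      ∸ δ c c′
      ≡⟨ cong (_∸ δ c c′) (Σ-⊕ (allFin n) _ _) ⟩
    (avail (S ∪｛ a ｝) c′ + Σ (allFin n) (λ j → [ does (a ≟F j) ] * δ c c′)) ∸ δ c c′
      ≡⟨ cong (λ z → (avail (S ∪｛ a ｝) c′ + z) ∸ δ c c′)
              (Σ-pick _≟F_ a (allFin n) (λ _ → δ c c′) (allFin-once n a)) ⟩
    (avail (S ∪｛ a ｝) c′ + δ c c′) ∸ δ c c′
      ≡⟨ ℕP.m+n∸n≡m _ (δ c c′) ⟩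
    avail (S ∪｛ a ｝) c′ ∎)
    where
    open ≡-Reasoning
    split : ∀ j → [ not (S j) ∧ does (lookup u j ≟F c′) ] ≡
                  [ not ((S ∪｛ a ｝) j) ∧ does (lookup u j ≟F c′) ] + [ does (a ≟F j) ] * δ c c′
    split j with j ≟F a
    ... | yes refl rewrite a∉S | ua≡c | dec-true (j ≟F j) refl = sym (ℕP.+-identityʳ _)
    ... | no j≢a rewrite dec-false (a ≟F j) (j≢a ∘ sym) | ∨-identityʳ (S j) = sym (ℕP.+-identityʳ _)

  readings-falling : ∀ {k} S (w : Word M k) →
                     readings S w ≡ Π (allFin (suc M)) (λ c → falling (avail S c) (occ w c))
  readings-falling S []      = sym (Π-one (allFin (suc M)))
  readings-falling S (c ∷ w) = begin
    readings S (c ∷ w)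
      ≡⟨ readings-step S c w ⟩
    Σ (allFin n) (λ a → h a * readings (S ∪｛ a ｝) w)
      ≡⟨ Σ-cong (allFin n) (λ a → []-cong (not (S a) ∧ does (lookup u a ≟F c)) (λ ok →
           trans (readings-falling (S ∪｛ a ｝) w) (fewer a ok))) ⟩
    Σ (allFin n) (λ a → h a * rest)
      ≡⟨ Σ-⊗ʳ rest (allFin n) h ⟨
    avail S c * rest
      ≡⟨ falling-step c (avail S) (occ w) ⟩
    Π (allFin (suc M)) (λ c′ → falling (avail S c′) (occ (c ∷ w) c′)) ∎
    where
    open ≡-Reasoning
    h : Fin n → ℕ
    h a = [ not (S a) ∧ does (lookup u a ≟F c) ]
    rest : ℕ
    rest = Π (allFin (suc M)) (λ c′ → falling (avail S c′ ∸ δ c c′) (occ w c′))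
    fewer : ∀ a → (not (S a) ∧ does (lookup u a ≟F c)) ≡ true →
            Π (allFin (suc M)) (λ c′ → falling (avail (S ∪｛ a ｝) c′) (occ w c′)) ≡ rest
    fewer a ok with ∧-true {not (S a)} ok
    ... | a∉S , ua≡c = Π-cong (allFin (suc M)) (λ c′ →
          cong (λ z → falling z (occ w c′))
               (avail-step S a c (not-true a∉S) (from-does (lookup u a ≟F c) ua≡c) c′))

  -- Π_c s_c(u)!, the order of the stabiliser of u in Sₙ
  stabiliser : ℕ
  stabiliser = Π (allFin (suc M)) (λ c → occ u c !)

  -- with no position used yet, the readings of w are the permutations σ with
  -- u^σ = w; the falling factorials are full factorials when s(u) = s(w), and
  -- one of them vanishes otherwise (some letter is needed more often than u has it)
  orbit-count : (w : Word M n) →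
                Σ (Sym n) (λ σ → [ (u ^σ σ) ≟W w ]) ≡ [ does (composition u ≟V composition w) ] * stabiliser
  orbit-count w = trans as-falling (by-composition (composition u ≟V composition w))
    where
    open ≡-Reasoning
    occs : Fin (suc M) → ℕ
    occs c = falling (occ u c) (occ w c)
    as-falling : Σ (Sym n) (λ σ → [ (u ^σ σ) ≟W w ]) ≡ Π (allFin (suc M)) occs
    as-falling = begin
      Σ (Sym n) (λ σ → [ (u ^σ σ) ≟W w ])
        ≡⟨ Σ-filter isInjectiveᵇ (allVecs (allFin n) n) _ ⟩
      Σ (allVecs (allFin n) n) (λ σ → [ isInjectiveᵇ σ ] * [ (u ^σ σ) ≟W w ])
        ≡⟨ Σ-cong (allVecs (allFin n) n) (λ σ → trans (sym ([]-∧ (isInjectiveᵇ σ) _))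
             (cong (λ b → [ b ∧ ((u ^σ σ) ≟W w) ]) (isInjectiveᵇ≡fresh σ))) ⟩
      readings (λ _ → false) w
        ≡⟨ readings-falling (λ _ → false) w ⟩
      Π (allFin (suc M)) (λ c → falling (avail (λ _ → false) c) (occ w c))
        ≡⟨ Π-cong (allFin (suc M)) (λ c → cong (λ z → falling z (occ w c)) (sym (Σ-toList u _))) ⟩
      Π (allFin (suc M)) occs ∎
    by-composition : (d : Dec (composition u ≡ composition w)) →
                     Π (allFin (suc M)) occs ≡ [ does d ] * stabiliser
    by-composition (yes u≈w) = trans (Π-cong (allFin (suc M)) same) (sym (ℕP.+-identityʳ _))
      where
      same : ∀ c → occs c ≡ occ u c !
      same c = trans (cong (falling (occ u c)) (trans (sym (composition-lookup w c))
                 (trans (cong (λ s → lookup s c) (sym u≈w)) (composition-lookup u c)))) (falling-refl (occ u c))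
    by-composition (no u≉w) with composition-≢ u w u≉w
    ... | c , u<w = Π-scale _≟F_ c (allFin (suc M)) occs occs 0 (allFin-once (suc M) c)
                      (λ _ _ → refl) (falling-zero (occ u c) (occ w c) u<w)

  -- |Sₙ| = |orbit of u| · |stabiliser of u|
  orbit-stabiliser : multinomial n (composition u) * stabiliser ≡ n !
  orbit-stabiliser = begin
    multinomial n (composition u) * stabiliser
      ≡⟨ cong₂ (λ m p → multinomial m (composition u) * p) (sym length-u)
               (Π-cong (allFin (suc M)) (λ c → cong _! (sym (composition-lookup u c)))) ⟩
    multinomial (V.sum (composition u)) (composition u) * Π (allFin (suc M)) (λ c → lookup (composition u) c !)
      ≡⟨ multinomial-exact (composition u) ⟩
    V.sum (composition u) !
      ≡⟨ cong _! length-u ⟩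
    n ! ∎
    where
    open ≡-Reasoning
    length-u : V.sum (composition u) ≡ n
    length-u = trans (Vsum-lookup (composition u))
                     (trans (Σ-cong (allFin (suc M)) (composition-lookup u)) (occ-total u))

-- The fibre count  #{w : η(w,v) = e} = [s(v) = col(e)] · Π_β multinomial(col_β(e))

Π-nonZero : ∀ {X : Set} (xs : List X) (f : X → ℕ) → (∀ x → ℕ.NonZero (f x)) → ℕ.NonZero (Π xs f)
Π-nonZero []       f nz = _
Π-nonZero (x ∷ xs) f nz = ℕP.m*n≢0 (f x) (Π xs f) {{nz x}} {{Π-nonZero xs f nz}}

factorial-pred : ∀ x → 1 ≤ x → x ! ≡ x * (x ∸ 1) !
factorial-pred (suc x) _ = refl

module FibreCount (M : ℕ) where

  letters : List (Fin (suc M))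
  letters = allFin (suc M)

  _≟T_ : DecidableEquality (BiComp M)
  _≟T_ = ≡-dec _≟V_

  table-ext : (t e : BiComp M) → (∀ α β → η_ t α β ≡ η_ e α β) → t ≡ e
  table-ext t e h = vec-ext t e (λ α → vec-ext (lookup t α) (lookup e α) (h α))

  pairCount : ∀ {k} → Word M k → Word M k → Fin (suc M) → Fin (suc M) → ℕ
  pairCount w v α β = Σ (V.toList (V.zip w v)) (λ p → [ does (proj₁ p ≟F α) ∧ does (proj₂ p ≟F β) ])

  biComposition-lookup : ∀ {k} (w v : Word M k) α β → η_ (biComposition w v) α β ≡ pairCount w v α β
  biComposition-lookup w v α β =
    trans (cong (λ r → lookup r β)
                (lookup∘tabulate (λ α → tabulate (λ β → countᵇ (pair α β) (V.zip w v))) α))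
          (trans (lookup∘tabulate (λ β → countᵇ (pair α β) (V.zip w v)) β)
                 (length-filter (pair α β) (V.toList (V.zip w v))))
    where
    pair : Fin (suc M) → Fin (suc M) → Fin (suc M) × Fin (suc M) → Bool
    pair α β p = does (proj₁ p ≟F α) ∧ does (proj₂ p ≟F β)

  unit : Fin (suc M) → Fin (suc M) → Fin (suc M) → Fin (suc M) → ℕ
  unit a b α β = [ does (a ≟F α) ∧ does (b ≟F β) ]

  unit-off : ∀ a b α β → a ≢ α ⊎ b ≢ β → unit a b α β ≡ 0
  unit-off a b α β (inj₁ a≢α) rewrite dec-false (a ≟F α) a≢α = refl
  unit-off a b α β (inj₂ b≢β) with does (a ≟F α)
  ... | true  rewrite dec-false (b ≟F β) b≢β = refl
  ... | false = refl

  unit-at : ∀ a b → unit a b a b ≡ 1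
  unit-at a b rewrite dec-true (a ≟F a) refl | dec-true (b ≟F b) refl = refl

  unit-row : ∀ a b α → Σ letters (unit a b α) ≡ δ a α
  unit-row a b α = begin
    Σ letters (λ β → [ does (a ≟F α) ∧ does (b ≟F β) ])
                                                         ≡⟨ Σ-cong letters (λ β → []-∧ (does (a ≟F α)) _) ⟩
    Σ letters (λ β → δ a α * δ b β)                      ≡⟨ Σ-⊗ˡ (δ a α) letters (δ b) ⟨
    δ a α * Σ letters (δ b)                              ≡⟨ cong (δ a α *_) (allFin-once (suc M) b) ⟩
    δ a α * 1                                            ≡⟨ ℕP.*-identityʳ _ ⟩
    δ a α                                                ∎
    where open ≡-Reasoning

  unit-column : ∀ a b β → Σ letters (λ α → unit a b α β) ≡ δ b β
  unit-column a b β = begin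
    Σ letters (λ α → [ does (a ≟F α) ∧ does (b ≟F β) ])
                                                         ≡⟨ Σ-cong letters (λ α → []-∧ (does (a ≟F α)) _) ⟩
    Σ letters (λ α → δ a α * δ b β)                      ≡⟨ Σ-⊗ʳ (δ b β) letters (δ a) ⟨
    Σ letters (δ a) * δ b β                              ≡⟨ cong (_* δ b β) (allFin-once (suc M) a) ⟩
    1 * δ b β                                            ≡⟨ ℕP.*-identityˡ _ ⟩
    δ b β                                                ∎
    where open ≡-Reasoning

  remove : Fin (suc M) → Fin (suc M) → BiComp M → BiComp M
  remove a b e = tabulate (λ α → tabulate (λ β → η_ e α β ∸ unit a b α β))

  remove-lookup : ∀ a b e α β → η_ (remove a b e) α β ≡ η_ e α β ∸ unit a b α β
  remove-lookup a b e α β =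
    trans (cong (λ r → lookup r β)
                (lookup∘tabulate (λ α → tabulate (λ β → η_ e α β ∸ unit a b α β)) α))
          (lookup∘tabulate (λ β → η_ e α β ∸ unit a b α β) β)

  remove-off : ∀ a b e α β → a ≢ α ⊎ b ≢ β → η_ (remove a b e) α β ≡ η_ e α β
  remove-off a b e α β off = trans (remove-lookup a b e α β) (cong (η_ e α β ∸_) (unit-off a b α β off))

  remove-restore : ∀ a b e → 1 ≤ η_ e a b → ∀ α β → unit a b α β + η_ (remove a b e) α β ≡ η_ e α β
  remove-restore a b e ab≥1 α β rewrite remove-lookup a b e α β with a ≟F α | b ≟F β
  ... | yes refl | yes refl = ℕP.m+[n∸m]≡n ab≥1
  ... | yes _    | no _     = refl
  ... | no _     | _        = refl

  colSum : BiComp M → Fin (suc M) → ℕ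
  colSum e β = Σ letters (λ α → η_ e α β)

  colComp-lookup : ∀ e β → lookup (colComp e) β ≡ colSum e β
  colComp-lookup e β = trans (lookup∘tabulate (λ j → V.sum (tabulate (λ i → η_ e i j))) β)
                             (Vsum-tabulate (suc M) (λ α → η_ e α β))

  colSum-remove : ∀ a b e → 1 ≤ η_ e a b → ∀ β → colSum e β ≡ δ b β + colSum (remove a b e) β
  colSum-remove a b e ab≥1 β = begin
    colSum e β
      ≡⟨ Σ-cong letters (λ α → remove-restore a b e ab≥1 α β) ⟨
    Σ letters (λ α → unit a b α β + η_ (remove a b e) α β)
      ≡⟨ Σ-⊕ letters (λ α → unit a b α β) (λ α → η_ (remove a b e) α β) ⟩
    Σ letters (λ α → unit a b α β) + colSum (remove a b e) β
      ≡⟨ cong (_+ colSum (remove a b e) β) (unit-column a b β) ⟩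
    δ b β + colSum (remove a b e) β ∎
    where open ≡-Reasoning

  zero-entries : ∀ e → (∀ β → colSum e β ≡ 0) → ∀ α β → η_ e α β ≡ 0
  zero-entries e col≡0 α β =
    Σ-≤-≡ letters (λ α → η_ e α β) (λ _ → 0) (λ _ → z≤n)
          (trans (col≡0 β) (sym (Σ-zero letters))) (∈-allFin α)

  fits : ∀ {k} → Word M k → BiComp M → Bool
  fits v e = does (composition v ≟V colComp e)

  fits⇔ : ∀ {k} (v : Word M k) e → composition v ≡ colComp e ⇔ (∀ β → occ v β ≡ colSum e β)
  fits⇔ v e = mk⇔
    (λ eq β → trans (sym (composition-lookup v β)) (trans (cong (λ s → lookup s β) eq) (colComp-lookup e β)))
    (λ h → vec-ext _ _ (λ β → trans (composition-lookup v β) (trans (h β) (sym (colComp-lookup e β)))))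

  fits-remove : ∀ {k} a b (v : Word M k) e → 1 ≤ η_ e a b → fits v (remove a b e) ≡ fits (b ∷ v) e
  fits-remove a b v e ab≥1 = does-⇔ (mk⇔ to from) (_ ≟V _) (_ ≟V _)
    where
    to : composition v ≡ colComp (remove a b e) → composition (b ∷ v) ≡ colComp e
    to eq = Equivalence.from (fits⇔ (b ∷ v) e) (λ β →
      trans (cong (δ b β +_) (Equivalence.to (fits⇔ v (remove a b e)) eq β)) (sym (colSum-remove a b e ab≥1 β)))
    from : composition (b ∷ v) ≡ colComp e → composition v ≡ colComp (remove a b e)
    from eq = Equivalence.from (fits⇔ v (remove a b e)) (λ β → ℕP.+-cancelˡ-≡ (δ b β) _ _
      (trans (Equivalence.to (fits⇔ (b ∷ v) e) eq β) (colSum-remove a b e ab≥1 β)))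

  fits-head : ∀ {k} b (v : Word M k) e → fits (b ∷ v) e ≡ true → 1 ≤ colSum e b
  fits-head b v e ok =
    subst (1 ≤_) (Equivalence.to (fits⇔ (b ∷ v) e) (from-does (_ ≟V _) ok) b)
          (subst (λ z → 1 ≤ z + occ v b) (sym (cong [_] (dec-true (b ≟F b) refl))) (s≤s z≤n))

  fibre : ∀ {k} → Word M k → BiComp M → ℕ
  fibre {k} v e = Σ (allWords M k) (λ w → [ does (biComposition w v ≟T e) ])

  biComposition-step : ∀ {k} a b (w v : Word M k) e →
                       does (biComposition (a ∷ w) (b ∷ v) ≟T e) ≡
                       does (1 ℕ.≤? η_ e a b) ∧ does (biComposition w v ≟T remove a b e)
  biComposition-step a b w v e = does-⇔ (mk⇔ to from) (_ ≟T _) ((1 ℕ.≤? η_ e a b) ×-dec (_ ≟T _))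
    where
    to : biComposition (a ∷ w) (b ∷ v) ≡ e → 1 ≤ η_ e a b × biComposition w v ≡ remove a b e
    to refl = ab≥1 , table-ext _ _ (λ α β → sym (begin
      η_ (remove a b e) α β                                      ≡⟨ remove-lookup a b e α β ⟩
      η_ e α β ∸ unit a b α β
        ≡⟨ cong (_∸ unit a b α β) (biComposition-lookup (a ∷ w) (b ∷ v) α β) ⟩
      (unit a b α β + pairCount w v α β) ∸ unit a b α β          ≡⟨ ℕP.m+n∸m≡n (unit a b α β) _ ⟩
      pairCount w v α β                                          ≡⟨ biComposition-lookup w v α β ⟨
      η_ (biComposition w v) α β                                 ∎))
      where
      open ≡-Reasoning
      ab≥1 : 1 ≤ η_ (biComposition (a ∷ w) (b ∷ v)) a b
      ab≥1 = subst (1 ≤_) (sym (biComposition-lookup (a ∷ w) (b ∷ v) a b))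
                   (subst (λ z → 1 ≤ z + pairCount w v a b) (sym (unit-at a b)) (s≤s z≤n))
    from : 1 ≤ η_ e a b × biComposition w v ≡ remove a b e → biComposition (a ∷ w) (b ∷ v) ≡ e
    from (ab≥1 , wv≡e′) = table-ext _ _ (λ α β →
      trans (biComposition-lookup (a ∷ w) (b ∷ v) α β)
            (trans (cong (unit a b α β +_)
                         (trans (sym (biComposition-lookup w v α β)) (cong (λ t → η_ t α β) wv≡e′)))
                   (remove-restore a b e ab≥1 α β)))

  -- choosing the first letter a of w
  fibre-step : ∀ {k} b (v : Word M k) e →
               fibre (b ∷ v) e ≡ Σ letters (λ a → [ does (1 ℕ.≤? η_ e a b) ] * fibre v (remove a b e))
  fibre-step {k} b v e = begin
    fibre (b ∷ v) e
      ≡⟨ Σ-concatMap (λ a → L.map (a ∷_) (allWords M k)) letters _ ⟩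
    Σ letters (λ a → Σ (L.map (a ∷_) (allWords M k)) (λ w → [ does (biComposition w (b ∷ v) ≟T e) ]))
      ≡⟨ Σ-cong letters (λ a → Σ-map (a ∷_) (allWords M k) _) ⟩
    Σ letters (λ a → Σ (allWords M k) (λ w → [ does (biComposition (a ∷ w) (b ∷ v) ≟T e) ]))
      ≡⟨ Σ-cong letters (λ a → Σ-cong (allWords M k) (λ w →
           trans (cong [_] (biComposition-step a b w v e)) ([]-∧ (does (1 ℕ.≤? η_ e a b)) _))) ⟩
    Σ letters (λ a → Σ (allWords M k) (λ w →
        [ does (1 ℕ.≤? η_ e a b) ] * [ does (biComposition w v ≟T remove a b e) ]))
      ≡⟨ Σ-cong letters (λ a → Σ-⊗ˡ [ does (1 ℕ.≤? η_ e a b) ] (allWords M k) _) ⟨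
    Σ letters (λ a → [ does (1 ℕ.≤? η_ e a b) ] * fibre v (remove a b e)) ∎
    where open ≡-Reasoning

  entryFactorials : BiComp M → ℕ
  entryFactorials e = Π letters (λ β → Π letters (λ α → η_ e α β !))

  columnFactorials : BiComp M → ℕ
  columnFactorials e = Π letters (λ β → colSum e β !)

  columnFactorials↓ : Fin (suc M) → BiComp M → ℕ
  columnFactorials↓ b e = Π letters (λ β → (colSum e β ∸ δ b β) !)

  entryFactorials-remove : ∀ a b e → 1 ≤ η_ e a b →
                           entryFactorials e ≡ η_ e a b * entryFactorials (remove a b e)
  entryFactorials-remove a b e ab≥1 =
    Π-scale _≟F_ b letters _ _ (η_ e a b) (allFin-once (suc M) b) other-column column-b
    where
    other-column : ∀ β → b ≢ β →
                   Π letters (λ α → η_ e α β !) ≡ Π letters (λ α → η_ (remove a b e) α β !)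
    other-column β b≢β = Π-cong letters (λ α → cong _! (sym (remove-off a b e α β (inj₂ b≢β))))
    column-b : Π letters (λ α → η_ e α b !) ≡ η_ e a b * Π letters (λ α → η_ (remove a b e) α b !)
    column-b = Π-scale _≟F_ a letters _ _ (η_ e a b) (allFin-once (suc M) a)
      (λ α a≢α → cong _! (sym (remove-off a b e α b (inj₁ a≢α))))
      (trans (factorial-pred (η_ e a b) ab≥1)
             (cong (λ z → η_ e a b * z !)
                   (sym (trans (remove-lookup a b e a b) (cong (η_ e a b ∸_) (unit-at a b))))))

  columnFactorials-remove : ∀ a b e → 1 ≤ η_ e a b → columnFactorials (remove a b e) ≡ columnFactorials↓ b e
  columnFactorials-remove a b e ab≥1 = Π-cong letters (λ β → cong _!
    (sym (trans (cong (_∸ δ b β) (colSum-remove a b e ab≥1 β)) (ℕP.m+n∸m≡n (δ b β) _))))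

  columnFactorials-split : ∀ b e → 1 ≤ colSum e b → columnFactorials e ≡ colSum e b * columnFactorials↓ b e
  columnFactorials-split b e b≥1 = Π-scale _≟F_ b letters _ _ (colSum e b) (allFin-once (suc M) b) off at
    where
    off : ∀ β → b ≢ β → colSum e β ! ≡ (colSum e β ∸ δ b β) !
    off β b≢β rewrite dec-false (b ≟F β) b≢β = refl
    at : colSum e b ! ≡ colSum e b * (colSum e b ∸ δ b b) !
    at rewrite dec-true (b ≟F b) refl = factorial-pred (colSum e b) b≥1

  -- the empty word fits exactly the zero table, whose fibre is {[]}
  fibre-count-[] : ∀ e → fibre [] e * entryFactorials e ≡ [ fits [] e ] * columnFactorials e
  fibre-count-[] e = begin
    fibre [] e * entryFactorials e
      ≡⟨ cong (_* entryFactorials e) (trans (ℕP.+-identityʳ _) (cong [_] zero-table)) ⟩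
    [ fits [] e ] * entryFactorials e
      ≡⟨ []-cong (fits [] e) (λ ok → trans (all-one ok) (sym (columns-one ok))) ⟩
    [ fits [] e ] * columnFactorials e ∎
    where
    open ≡-Reasoning
    empty-columns : fits [] e ≡ true → ∀ β → colSum e β ≡ 0
    empty-columns ok β = sym (Equivalence.to (fits⇔ [] e) (from-does (_ ≟V _) ok) β)
    zero-table : does (biComposition [] [] ≟T e) ≡ fits [] e
    zero-table = does-⇔ (mk⇔
      (λ { refl → Equivalence.from (fits⇔ [] e) (λ β →
                 sym (trans (Σ-cong letters (λ α → biComposition-lookup [] [] α β)) (Σ-zero letters))) })
      (λ eq → table-ext (biComposition [] []) e (λ α β → trans (biComposition-lookup [] [] α β)
                 (sym (zero-entries e (λ β → sym (Equivalence.to (fits⇔ [] e) eq β)) α β)))))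
      (biComposition [] [] ≟T e) (composition {M} {0} [] ≟V colComp e)
    all-one : fits [] e ≡ true → entryFactorials e ≡ 1
    all-one ok = trans (Π-cong letters (λ β → trans (Π-cong letters (λ α →
                   cong _! (zero-entries e (empty-columns ok) α β))) (Π-one letters))) (Π-one letters)
    columns-one : fits [] e ≡ true → columnFactorials e ≡ 1
    columns-one ok = trans (Π-cong letters (λ β → cong _! (empty-columns ok β))) (Π-one letters)

  -- the fibre count, multiplied through by the entry factorials
  fibre-count : ∀ {k} (v : Word M k) e → fibre v e * entryFactorials e ≡ [ fits v e ] * columnFactorials e
  fibre-count []      e = fibre-count-[] e
  fibre-count (b ∷ v) e = begin
    fibre (b ∷ v) e * entryFactorials e
      ≡⟨ cong (_* entryFactorials e) (fibre-step b v e) ⟩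
    Σ letters (λ a → [ does (1 ℕ.≤? η_ e a b) ] * fibre v (remove a b e)) * entryFactorials e
      ≡⟨ Σ-⊗ʳ (entryFactorials e) letters (λ a → [ does (1 ℕ.≤? η_ e a b) ] * fibre v (remove a b e)) ⟩
    Σ letters (λ a → [ does (1 ℕ.≤? η_ e a b) ] * fibre v (remove a b e) * entryFactorials e)
      ≡⟨ Σ-cong letters (λ a → through a (1 ℕ.≤? η_ e a b)) ⟩
    Σ letters (λ a → η_ e a b * ([ fits (b ∷ v) e ] * columnFactorials↓ b e))
      ≡⟨ Σ-⊗ʳ ([ fits (b ∷ v) e ] * columnFactorials↓ b e) letters (λ a → η_ e a b) ⟨
    colSum e b * ([ fits (b ∷ v) e ] * columnFactorials↓ b e)
      ≡⟨ x∙yz≈y∙xz (colSum e b) [ fits (b ∷ v) e ] (columnFactorials↓ b e) ⟩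
    [ fits (b ∷ v) e ] * (colSum e b * columnFactorials↓ b e)
      ≡⟨ []-cong (fits (b ∷ v) e) (λ ok → sym (columnFactorials-split b e (fits-head b v e ok))) ⟩
    [ fits (b ∷ v) e ] * columnFactorials e ∎
    where
    open ≡-Reasoning
    open CommSemigroupProps ℕP.*-commutativeSemigroup using (x∙yz≈y∙xz)
    through : ∀ a (ab≥1? : Dec (1 ≤ η_ e a b)) →
              [ does ab≥1? ] * fibre v (remove a b e) * entryFactorials e ≡
              η_ e a b * ([ fits (b ∷ v) e ] * columnFactorials↓ b e)
    through a (no ab≱1) =
      cong (_* ([ fits (b ∷ v) e ] * columnFactorials↓ b e)) (sym (ℕP.n<1⇒n≡0 (ℕP.≰⇒> ab≱1)))
    through a (yes ab≥1) = begin
      (1 * fibre v e′) * entryFactorials e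
        ≡⟨ cong₂ _*_ (ℕP.*-identityˡ (fibre v e′)) (entryFactorials-remove a b e ab≥1) ⟩
      fibre v e′ * (η_ e a b * entryFactorials e′)
        ≡⟨ x∙yz≈y∙xz (fibre v e′) (η_ e a b) (entryFactorials e′) ⟩
      η_ e a b * (fibre v e′ * entryFactorials e′)
        ≡⟨ cong (η_ e a b *_) (fibre-count v e′) ⟩
      η_ e a b * ([ fits v e′ ] * columnFactorials e′)
        ≡⟨ cong (λ z → η_ e a b * ([ z ] * columnFactorials e′)) (fits-remove a b v e ab≥1) ⟩
      η_ e a b * ([ fits (b ∷ v) e ] * columnFactorials e′)
        ≡⟨ cong (λ z → η_ e a b * ([ fits (b ∷ v) e ] * z)) (columnFactorials-remove a b e ab≥1) ⟩
      η_ e a b * ([ fits (b ∷ v) e ] * columnFactorials↓ b e) ∎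
      where e′ = remove a b e

  columnMultinomials : BiComp M → ℕ
  columnMultinomials e = Π letters (λ i → multinomial (lookup (colComp e) i) (column e i))

  columnMultinomials-exact : ∀ e → columnMultinomials e * entryFactorials e ≡ columnFactorials e
  columnMultinomials-exact e =
    trans (Π-⊗ letters (λ i → multinomial (lookup (colComp e) i) (column e i))
                       (λ i → Π letters (λ α → η_ e α i !)))
          (Π-cong letters column-exact)
    where
    column-exact : ∀ i → multinomial (lookup (colComp e) i) (column e i) * Π letters (λ α → η_ e α i !) ≡
                         colSum e i !
    column-exact i = begin
      multinomial (lookup (colComp e) i) (column e i) * Π letters (λ α → η_ e α i !)
        ≡⟨ cong₂ (λ s p → multinomial s (column e i) * p)
                 (lookup∘tabulate (λ j → V.sum (tabulate (λ α → η_ e α j))) i)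
                 (Π-cong letters (λ α → cong _! (sym (lookup∘tabulate (λ α → η_ e α i) α)))) ⟩
      multinomial (V.sum (column e i)) (column e i) * Π letters (λ α → lookup (column e i) α !)
        ≡⟨ multinomial-exact (column e i) ⟩
      V.sum (column e i) !
        ≡⟨ cong _! (Vsum-tabulate (suc M) (λ α → η_ e α i)) ⟩
      colSum e i ! ∎
      where open ≡-Reasoning

  fibre-multinomial : ∀ {k} (v : Word M k) e → fibre v e ≡ [ fits v e ] * columnMultinomials e
  fibre-multinomial v e = ℕP.*-cancelʳ-≡ _ _ (entryFactorials e) {{entryFactorials≢0}} (begin
    fibre v e * entryFactorials e
      ≡⟨ fibre-count v e ⟩
    [ fits v e ] * columnFactorials e
      ≡⟨ cong ([ fits v e ] *_) (columnMultinomials-exact e) ⟨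
    [ fits v e ] * (columnMultinomials e * entryFactorials e)
      ≡⟨ ℕP.*-assoc [ fits v e ] _ _ ⟨
    [ fits v e ] * columnMultinomials e * entryFactorials e ∎)
    where
    open ≡-Reasoning
    entryFactorials≢0 : ℕ.NonZero (entryFactorials e)
    entryFactorials≢0 = Π-nonZero letters _ (λ β → Π-nonZero letters _ (λ α → ℕP._!≢0 (η_ e α β)))

  pairCount-row : ∀ {k} (w v : Word M k) α → Σ letters (pairCount w v α) ≡ occ w α
  pairCount-row []      []      α = Σ-zero letters
  pairCount-row (a ∷ w) (b ∷ v) α =
    trans (Σ-⊕ letters (unit a b α) (pairCount w v α)) (cong₂ _+_ (unit-row a b α) (pairCount-row w v α))

  rowComp-biComposition : ∀ {k} (w v : Word M k) → rowComp (biComposition w v) ≡ composition w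
  rowComp-biComposition w v = vec-ext _ _ (λ α → begin
    lookup (V.map V.sum (biComposition w v)) α        ≡⟨ lookup-map α V.sum (biComposition w v) ⟩
    V.sum (lookup (biComposition w v) α)              ≡⟨ Vsum-lookup (lookup (biComposition w v) α) ⟩
    Σ letters (lookup (lookup (biComposition w v) α)) ≡⟨ Σ-cong letters (biComposition-lookup w v α) ⟩
    Σ letters (pairCount w v α)                        ≡⟨ pairCount-row w v α ⟩
    occ w α                                            ≡⟨ composition-lookup w α ⟨
    lookup (composition w) α                           ∎)
    where open ≡-Reasoning

  total-biComposition : ∀ {k} (w v : Word M k) → total (biComposition w v) ≡ k
  total-biComposition w v = begin
    V.sum (rowComp (biComposition w v)) ≡⟨ cong V.sum (rowComp-biComposition w v) ⟩
    V.sum (composition w)               ≡⟨ Vsum-lookup (composition w) ⟩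
    Σ letters (lookup (composition w))  ≡⟨ Σ-cong letters (composition-lookup w) ⟩
    Σ letters (occ w)                   ≡⟨ occ-total w ⟩
    _                                   ∎
    where open ≡-Reasoning

  pairCount-≤ : ∀ {k} (w v : Word M k) α β → pairCount w v α β ≤ k
  pairCount-≤ []      []      α β = z≤n
  pairCount-≤ (a ∷ w) (b ∷ v) α β =
    ℕP.+-mono-≤ (indicator-≤ (does (a ≟F α) ∧ does (b ≟F β))) (pairCount-≤ w v α β)
    where
    indicator-≤ : ∀ x → [ x ] ≤ 1
    indicator-≤ true  = ℕP.≤-refl
    indicator-≤ false = z≤n

  biCompositions-once : ∀ {n} (w v : Word M n) → OccursOnce _≟T_ (biComposition w v) (biCompositions M n)
  biCompositions-once {n} w v = begin
    Σ (biCompositions M n) (λ e → [ does (t ≟T e) ])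
      ≡⟨ Σ-filter sized tables _ ⟩
    Σ tables (λ e → [ sized e ] * [ does (t ≟T e) ])
      ≡⟨ Σ-cong tables drop-size ⟩
    Σ tables (λ e → [ does (t ≟T e) ])
      ≡⟨ allVecs-once _≟V_ rows (suc M) t (λ α → allVecs-once ℕ._≟_ (upTo (suc n)) (suc M) (lookup t α)
           (λ β → upTo-once n (η_ t α β) (entry-≤ α β))) ⟩
    1 ∎
    where
    open ≡-Reasoning
    t : BiComp M
    t = biComposition w v
    sized : BiComp M → Bool
    sized e = does (total e ℕ.≟ n)
    rows : List (Vec ℕ (suc M))
    rows = allVecs (upTo (suc n)) (suc M)
    tables : List (BiComp M)
    tables = allVecs rows (suc M)
    entry-≤ : ∀ α β → η_ t α β ≤ n
    entry-≤ α β = subst (_≤ n) (sym (biComposition-lookup w v α β)) (pairCount-≤ w v α β)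
    drop-size : ∀ e → [ sized e ] * [ does (t ≟T e) ] ≡ [ does (t ≟T e) ]
    drop-size e with t ≟T e
    ... | yes refl = cong (λ b → [ b ] * 1) (dec-true (total t ℕ.≟ n) (total-biComposition w v))
    ... | no  _    = ℕP.*-zeroʳ [ sized e ]

allWords-onceℚ : ∀ M n (w : Word M n) → Σℚ (allWords M n) (λ v → ⟦ w ≟W v ⟧) ≡ 1ℚ
allWords-onceℚ M n w = trans (sym (toQ-count (allWords M n) (w ≟W_))) (cong toQ (allWords-once M n w))

module PermutedCode {M n : ℕ} (σ : Vec (Fin n) n) (σ-inj : InjectiveSeq σ) where

  τ : Fin n → Fin n
  τ j = proj₁ (injective⇒onto (lookup σ) σ-inj j)

  σ∘τ : ∀ j → lookup σ (τ j) ≡ j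
  σ∘τ j = proj₂ (injective⇒onto (lookup σ) σ-inj j)

  τ∘σ : ∀ i → τ (lookup σ i) ≡ i
  τ∘σ i = σ-inj _ _ (σ∘τ (lookup σ i))

  _^τ : Word M n → Word M n
  w ^τ = tabulate (λ j → lookup w (τ j))

  ^σ⇔^τ : ∀ u w → (u ^σ σ ≡ w) ⇔ (w ^τ ≡ u)
  ^σ⇔^τ u w = mk⇔
    (λ { refl → vec-ext _ _ (λ j →
           trans (lookup∘tabulate (λ j → lookup (u ^σ σ) (τ j)) j)
                 (trans (lookup∘tabulate (λ i → lookup u (lookup σ i)) (τ j)) (cong (lookup u) (σ∘τ j)))) })
    (λ { refl → vec-ext _ _ (λ i →
           trans (lookup∘tabulate (λ i → lookup (w ^τ) (lookup σ i)) i)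
                 (trans (lookup∘tabulate (λ j → lookup w (τ j)) (lookup σ i)) (cong (lookup w) (τ∘σ i)))) })

  permCode≡ : ∀ (C : Code M n) w → permCode C σ w ≡ C (w ^τ)
  permCode≡ C w = bool-ext to from
    where
    to : permCode C σ w ≡ true → C (w ^τ) ≡ true
    to h with anyᵇ-witness (λ u → C u ∧ ((u ^σ σ) ≟W w)) (allWords M n) h
    ... | u , ok with ∧-true {C u} ok
    ... | Cu , u^σ≡w rewrite Equivalence.to (^σ⇔^τ u w) (from-does (≡-dec _≟F_ (u ^σ σ) w) u^σ≡w) = Cu
    from : C (w ^τ) ≡ true → permCode C σ w ≡ true
    from Cw^τ = anyᵇ-intro (λ u → C u ∧ ((u ^σ σ) ≟W w)) (allWords M n)
      (once⇒∈ (≡-dec _≟F_) (allWords M n) (allWords-once M n (w ^τ)))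
      (cong₂ _∧_ Cw^τ (dec-true (≡-dec _≟F_ ((w ^τ) ^σ σ) w) (Equivalence.from (^σ⇔^τ (w ^τ) w) refl)))

  permuted-sum : ∀ (C : Code M n) (g : Word M n → ℚ) →
                 Σℚ (codewords (permCode C σ)) g ≡ Σℚ (codewords C) (λ u → g (u ^σ σ))
  permuted-sum C g = begin
    Σℚ (filterᵇ (permCode C σ) W) g
      ≡⟨ ℚΣ.Σ-filter (permCode C σ) W g ⟩
    Σℚ W (λ w → ⟦ permCode C σ w ⟧ ℚ.* g w)
      ≡⟨ ℚΣ.Σ-cong W (λ w → cong (λ b → ⟦ b ⟧ ℚ.* g w) (permCode≡ C w)) ⟩
    Σℚ W (λ w → ⟦ C (w ^τ) ⟧ ℚ.* g w)
      ≡⟨ ℚΣ.Σ-bijection (≡-dec _≟F_) W (allWords-onceℚ M n) (_^σ σ) _^τ ^σ⇔^τ _ ⟩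
    Σℚ W (λ u → ⟦ C ((u ^σ σ) ^τ) ⟧ ℚ.* g (u ^σ σ))
      ≡⟨ ℚΣ.Σ-cong W (λ u → cong (λ z → ⟦ C z ⟧ ℚ.* g (u ^σ σ))
                                 (Equivalence.to (^σ⇔^τ u (u ^σ σ)) refl)) ⟩
    Σℚ W (λ u → ⟦ C u ⟧ ℚ.* g (u ^σ σ))
      ≡⟨ ℚΣ.Σ-filter C W (λ u → g (u ^σ σ)) ⟨
    Σℚ (filterᵇ C W) (λ u → g (u ^σ σ)) ∎
    where
    open ≡-Reasoning
    W : List (Word M n)
    W = allWords M n

module Assembly {M n : ℕ} (x : Vars M) where
  open FibreCount M
  open OrbitCount using (stabiliser; orbit-count; orbit-stabiliser)
  open ≡-Reasoning
  open +-*-Solver using (solve; _:=_; _:*_)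

  1/n! : ℚ
  1/n! = ratio 1 (n !)

  W : List (Word M n)
  W = allWords M n

  BC : List (BiComp M)
  BC = biCompositions M n

  coefficient : BiComp M → ℚ
  coefficient e = ratio (columnMultinomials e) (multinomial n (rowComp e))

  rowFits : Word M n → BiComp M → Bool
  rowFits u e = does (composition u ≟V rowComp e)

  orbit-sum : ∀ u (g : Word M n → ℚ) →
              Σℚ (Sym n) (λ σ → g (u ^σ σ)) ≡
              Σℚ W (λ w → (⟦ does (composition u ≟V composition w) ⟧ ℚ.* toQ (stabiliser u)) ℚ.* g w)
  orbit-sum u g = begin
    Σℚ (Sym n) (λ σ → g (u ^σ σ))
      ≡⟨ ℚΣ.Σ-cong (Sym n) (λ σ →
           ℚΣ.Σ-pick (≡-dec _≟F_) (u ^σ σ) W g (allWords-onceℚ M n (u ^σ σ))) ⟨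
    Σℚ (Sym n) (λ σ → Σℚ W (λ w → ⟦ (u ^σ σ) ≟W w ⟧ ℚ.* g w))
      ≡⟨ ℚΣ.Σ-swap (Sym n) W _ ⟩
    Σℚ W (λ w → Σℚ (Sym n) (λ σ → ⟦ (u ^σ σ) ≟W w ⟧ ℚ.* g w))
      ≡⟨ ℚΣ.Σ-cong W (λ w → ℚΣ.Σ-⊗ʳ (g w) (Sym n) _) ⟨
    Σℚ W (λ w → Σℚ (Sym n) (λ σ → ⟦ (u ^σ σ) ≟W w ⟧) ℚ.* g w)
      ≡⟨ ℚΣ.Σ-cong W (λ w → cong (ℚ._* g w) (trans (sym (toQ-count (Sym n) (λ σ → (u ^σ σ) ≟W w)))
           (trans (cong toQ (orbit-count u w)) (toQ-[]* (does (composition u ≟V composition w)) (stabiliser u))))) ⟩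
    Σℚ W (λ w → (⟦ does (composition u ≟V composition w) ⟧ ℚ.* toQ (stabiliser u)) ℚ.* g w) ∎

  monomial-expand : ∀ (w v : Word M n) →
                    monomial x (biComposition w v) ≡
                    Σℚ BC (λ e → ⟦ does (biComposition w v ≟T e) ⟧ ℚ.* monomial x e)
  monomial-expand w v = sym (ℚΣ.Σ-pick _≟T_ (biComposition w v) BC (monomial x)
    (trans (sym (toQ-count BC (λ e → does (biComposition w v ≟T e)))) (cong toQ (biCompositions-once w v))))

  fibre-sum : ∀ (v : Word M n) e →
              Σℚ W (λ w → ⟦ does (biComposition w v ≟T e) ⟧) ≡
              ⟦ fits v e ⟧ ℚ.* toQ (columnMultinomials e)
  fibre-sum v e = trans (sym (toQ-count W (λ w → does (biComposition w v ≟T e))))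
                        (trans (cong toQ (fibre-multinomial v e)) (toQ-[]* (fits v e) (columnMultinomials e)))

  orbit-expansion : ∀ (u v : Word M n) →
    Σℚ (Sym n) (λ σ → monomial x (biComposition (u ^σ σ) v)) ≡
    Σℚ BC (λ e → (⟦ fits v e ⟧ ℚ.* toQ (columnMultinomials e)) ℚ.*
                   ((⟦ rowFits u e ⟧ ℚ.* toQ (stabiliser u)) ℚ.* monomial x e))
  orbit-expansion u v = begin
    Σℚ (Sym n) (λ σ → monomial x (biComposition (u ^σ σ) v))
      ≡⟨ orbit-sum u (λ w → monomial x (biComposition w v)) ⟩
    Σℚ W (λ w → orbit w ℚ.* monomial x (biComposition w v))
      ≡⟨ ℚΣ.Σ-cong W (λ w → cong (orbit w ℚ.*_) (monomial-expand w v)) ⟩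
    Σℚ W (λ w → orbit w ℚ.* Σℚ BC (λ e → hit w e ℚ.* monomial x e))
      ≡⟨ ℚΣ.Σ-cong W (λ w → trans (ℚΣ.Σ-⊗ˡ (orbit w) BC _) (ℚΣ.Σ-cong BC (λ e → regroup w e))) ⟩
    Σℚ W (λ w → Σℚ BC (λ e → hit w e ℚ.* weight e))
      ≡⟨ ℚΣ.Σ-swap W BC _ ⟩
    Σℚ BC (λ e → Σℚ W (λ w → hit w e ℚ.* weight e))
      ≡⟨ ℚΣ.Σ-cong BC (λ e → trans (sym (ℚΣ.Σ-⊗ʳ (weight e) W (λ w → hit w e)))
                                   (cong (ℚ._* weight e) (fibre-sum v e))) ⟩
    Σℚ BC (λ e → (⟦ fits v e ⟧ ℚ.* toQ (columnMultinomials e)) ℚ.* weight e) ∎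
    where
    orbit : Word M n → ℚ
    orbit w = ⟦ does (composition u ≟V composition w) ⟧ ℚ.* toQ (stabiliser u)
    hit : Word M n → BiComp M → ℚ
    hit w e = ⟦ does (biComposition w v ≟T e) ⟧
    weight : BiComp M → ℚ
    weight e = (⟦ rowFits u e ⟧ ℚ.* toQ (stabiliser u)) ℚ.* monomial x e
    -- when η(w,v) = e, the composition of w is the row composition of e
    regroup : ∀ w e → orbit w ℚ.* (hit w e ℚ.* monomial x e) ≡ hit w e ℚ.* weight e
    regroup w e = trans (x∙yz≈y∙xz (orbit w) (hit w e) (monomial x e))
      (ℚΣ.[]-cong (does (biComposition w v ≟T e)) (λ w↦e →
        cong (λ s → (⟦ does (composition u ≟V s) ⟧ ℚ.* toQ (stabiliser u)) ℚ.* monomial x e)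
             (row-composition w↦e)))
      where
      open CommSemigroupProps (CommutativeRing.*-commutativeSemigroup ℚP.+-*-commutativeRing)
        using (x∙yz≈y∙xz)
      row-composition : does (biComposition w v ≟T e) ≡ true → composition w ≡ rowComp e
      row-composition w↦e =
        trans (sym (rowComp-biComposition w v)) (cong rowComp (from-does (biComposition w v ≟T e) w↦e))

  coefficient-eq : ∀ (u : Word M n) e → rowFits u e ≡ true →
                   (1/n! ℚ.* toQ (stabiliser u)) ℚ.* toQ (columnMultinomials e) ≡ coefficient e
  coefficient-eq u e fits-row = trans (ratio-unique _ P d {{d≢0}} (begin
    ((1/n! ℚ.* toQ (stabiliser u)) ℚ.* toQ P) ℚ.* toQ d
      ≡⟨ solve 4 (λ r s p m → ((r :* s) :* p) :* m := (r :* (m :* s)) :* p) refl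
                 1/n! (toQ (stabiliser u)) (toQ P) (toQ d) ⟩
    (1/n! ℚ.* (toQ d ℚ.* toQ (stabiliser u))) ℚ.* toQ P
      ≡⟨ cong (λ z → (1/n! ℚ.* z) ℚ.* toQ P)
              (trans (sym (toQ-* d (stabiliser u))) (cong toQ (orbit-stabiliser u))) ⟩
    (1/n! ℚ.* toQ (n !)) ℚ.* toQ P
      ≡⟨ cong (ℚ._* toQ P) (ratio-solves 1 (n !) {{ℕP._!≢0 n}}) ⟩
    1ℚ ℚ.* toQ P
      ≡⟨ ℚP.*-identityˡ (toQ P) ⟩
    toQ P ∎))
    (cong (λ r → ratio P (multinomial n r)) (from-does (composition u ≟V rowComp e) fits-row))
    where
    P = columnMultinomials e
    d = multinomial n (composition u)
    d≢0 : ℕ.NonZero d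
    d≢0 = ℕP.m*n≢0⇒m≢0 d {{subst ℕ.NonZero (sym (orbit-stabiliser u)) (ℕP._!≢0 n)}}

  average-pair : ∀ (u v : Word M n) →
    1/n! ℚ.* Σℚ (Sym n) (λ σ → monomial x (biComposition (u ^σ σ) v)) ≡
    Σℚ BC (λ e → ((⟦ rowFits u e ⟧ ℚ.* ⟦ fits v e ⟧) ℚ.* coefficient e) ℚ.* monomial x e)
  average-pair u v = begin
    1/n! ℚ.* Σℚ (Sym n) (λ σ → monomial x (biComposition (u ^σ σ) v))
      ≡⟨ cong (1/n! ℚ.*_) (orbit-expansion u v) ⟩
    1/n! ℚ.* Σℚ BC summand
      ≡⟨ ℚΣ.Σ-⊗ˡ 1/n! BC summand ⟩
    Σℚ BC (λ e → 1/n! ℚ.* summand e)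
      ≡⟨ ℚΣ.Σ-cong BC averaged ⟩
    Σℚ BC (λ e → ((R e ℚ.* F e) ℚ.* coefficient e) ℚ.* monomial x e) ∎
    where
    F R : BiComp M → ℚ
    F e = ⟦ fits v e ⟧
    R e = ⟦ rowFits u e ⟧
    summand : BiComp M → ℚ
    summand e = (F e ℚ.* toQ (columnMultinomials e)) ℚ.* ((R e ℚ.* toQ (stabiliser u)) ℚ.* monomial x e)
    averaged : ∀ e → 1/n! ℚ.* summand e ≡ ((R e ℚ.* F e) ℚ.* coefficient e) ℚ.* monomial x e
    averaged e = begin
      1/n! ℚ.* ((F e ℚ.* p) ℚ.* ((R e ℚ.* s) ℚ.* m))
        ≡⟨ solve 6 (λ r f p ρ s m → r :* ((f :* p) :* ((ρ :* s) :* m)) := ρ :* (f :* (((r :* s) :* p) :* m)))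
                 refl 1/n! (F e) p (R e) s m ⟩
      R e ℚ.* (F e ℚ.* (((1/n! ℚ.* s) ℚ.* p) ℚ.* m))
        ≡⟨ ℚΣ.[]-cong (rowFits u e) (λ ok → cong (λ c → F e ℚ.* (c ℚ.* m)) (coefficient-eq u e ok)) ⟩
      R e ℚ.* (F e ℚ.* (coefficient e ℚ.* m))
        ≡⟨ solve 4 (λ ρ f c m → ρ :* (f :* (c :* m)) := ((ρ :* f) :* c) :* m)
                 refl (R e) (F e) (coefficient e) m ⟩
      ((R e ℚ.* F e) ℚ.* coefficient e) ℚ.* m ∎
      where
      p = toQ (columnMultinomials e)
      s = toQ (stabiliser u)
      m = monomial x e

  contribution : BiComp M → Word M n → Word M n → ℚ
  contribution e u v = ((⟦ rowFits u e ⟧ ℚ.* ⟦ fits v e ⟧) ℚ.* coefficient e) ℚ.* monomial x e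

  CJav-pairs : ∀ C D → CJav C D x ≡
    Σℚ (codewords C) (λ u → Σℚ (codewords D) (λ v →
      1/n! ℚ.* Σℚ (Sym n) (λ σ → monomial x (biComposition (u ^σ σ) v))))
  CJav-pairs C D = begin
    1/n! ℚ.* Σℚ (Sym n) (λ σ → CJ (permCode C σ) D x)
      ≡⟨ cong (1/n! ℚ.*_) (ℚΣ.Σ-filter-cong isInjectiveᵇ (allVecs (allFin n) n) (λ σ σ-inj →
           PermutedCode.permuted-sum σ (isInjectiveᵇ-sound σ σ-inj) C
             (λ w → Σℚ (codewords D) (λ v → monomial x (biComposition w v))))) ⟩
    1/n! ℚ.* Σℚ (Sym n) (λ σ → Σℚ (codewords C) (λ u → Σℚ (codewords D) (λ v → pair σ u v)))
      ≡⟨ cong (1/n! ℚ.*_) (ℚΣ.Σ-swap (Sym n) (codewords C) _) ⟩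
    1/n! ℚ.* Σℚ (codewords C) (λ u → Σℚ (Sym n) (λ σ → Σℚ (codewords D) (λ v → pair σ u v)))
      ≡⟨ ℚΣ.Σ-⊗ˡ (1/n!) (codewords C) _ ⟩
    Σℚ (codewords C) (λ u → 1/n! ℚ.* Σℚ (Sym n) (λ σ → Σℚ (codewords D) (λ v → pair σ u v)))
      ≡⟨ ℚΣ.Σ-cong (codewords C) (λ u →
           trans (cong (1/n! ℚ.*_) (ℚΣ.Σ-swap (Sym n) (codewords D) (λ σ → pair σ u)))
                                              (ℚΣ.Σ-⊗ˡ (1/n!) (codewords D) _)) ⟩
    Σℚ (codewords C) (λ u → Σℚ (codewords D) (λ v → 1/n! ℚ.* Σℚ (Sym n) (λ σ → pair σ u v))) ∎
    where
    pair : Vec (Fin n) n → Word M n → Word M n → ℚ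
    pair σ u v = monomial x (biComposition (u ^σ σ) v)

  A-sum : ∀ (E : Code M n) r → toQ (A E r) ≡ Σℚ (codewords E) (λ u → ⟦ does (composition u ≟V r) ⟧)
  A-sum E r = trans (cong toQ (length-filter (λ u → does (composition u ≟V r)) (codewords E)))
                    (toQ-count (codewords E) (λ u → does (composition u ≟V r)))

  RHS-expansion : ∀ C D → RHS C D x ≡
    Σℚ (codewords C) (λ u → Σℚ (codewords D) (λ v → Σℚ BC (λ e → contribution e u v)))
  RHS-expansion C D = begin
    Σℚ BC (λ e → toQ (A C (rowComp e) * A D (colComp e)) ℚ.* coefficient e ℚ.* monomial x e)
      ≡⟨ ℚΣ.Σ-cong BC per-table ⟩
    Σℚ BC (λ e → Σℚ (codewords C) (λ u → Σℚ (codewords D) (λ v → contribution e u v)))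
      ≡⟨ ℚΣ.Σ-swap BC (codewords C) _ ⟩
    Σℚ (codewords C) (λ u → Σℚ BC (λ e → Σℚ (codewords D) (λ v → contribution e u v)))
      ≡⟨ ℚΣ.Σ-cong (codewords C) (λ u → ℚΣ.Σ-swap BC (codewords D) (λ e v → contribution e u v)) ⟩
    Σℚ (codewords C) (λ u → Σℚ (codewords D) (λ v → Σℚ BC (λ e → contribution e u v))) ∎
    where
    per-table : ∀ e → toQ (A C (rowComp e) * A D (colComp e)) ℚ.* coefficient e ℚ.* monomial x e ≡
                      Σℚ (codewords C) (λ u → Σℚ (codewords D) (λ v → contribution e u v))
    per-table e = begin
      toQ (A C (rowComp e) * A D (colComp e)) ℚ.* coefficient e ℚ.* monomial x e
        ≡⟨ cong (λ z → z ℚ.* coefficient e ℚ.* monomial x e)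
                (trans (toQ-* (A C (rowComp e)) (A D (colComp e)))
                       (cong₂ ℚ._*_ (A-sum C (rowComp e)) (A-sum D (colComp e)))) ⟩
      (Σℚ (codewords C) ρ ℚ.* Σℚ (codewords D) φ) ℚ.* coefficient e ℚ.* monomial x e
        ≡⟨ cong (λ z → z ℚ.* coefficient e ℚ.* monomial x e)
                (trans (ℚΣ.Σ-⊗ʳ _ (codewords C) ρ)
                       (ℚΣ.Σ-cong (codewords C) (λ u → ℚΣ.Σ-⊗ˡ (ρ u) (codewords D) φ))) ⟩
      Σℚ (codewords C) (λ u → Σℚ (codewords D) (λ v → ρ u ℚ.* φ v)) ℚ.* coefficient e ℚ.* monomial x e
        ≡⟨ cong (ℚ._* monomial x e)
                (trans (ℚΣ.Σ-⊗ʳ (coefficient e) (codewords C) _)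
                       (ℚΣ.Σ-cong (codewords C) (λ u → ℚΣ.Σ-⊗ʳ (coefficient e) (codewords D) _))) ⟩
      Σℚ (codewords C) (λ u → Σℚ (codewords D) (λ v → (ρ u ℚ.* φ v) ℚ.* coefficient e)) ℚ.* monomial x e
        ≡⟨ trans (ℚΣ.Σ-⊗ʳ (monomial x e) (codewords C) _)
                 (ℚΣ.Σ-cong (codewords C) (λ u → ℚΣ.Σ-⊗ʳ (monomial x e) (codewords D) _)) ⟩
      Σℚ (codewords C) (λ u → Σℚ (codewords D) (λ v → contribution e u v)) ∎
      where
      ρ φ : Word M n → ℚ
      ρ u = ⟦ rowFits u e ⟧
      φ v = ⟦ fits v e ⟧

-- The theorem.

mainTheorem2 : (M : ℕ) (R : FinRing M) → IsFieldR R ⊎ IsZkR R →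
    (n : ℕ) (C D : Code M n) → IsLinear R C → IsLinear R D →
    (x : Vars M) → CJav C D x ≡ RHS C D x
mainTheorem2 M _ _ n C D _ _ x = begin
  CJav C D x
    ≡⟨ CJav-pairs C D ⟩
  Σℚ (codewords C) (λ u → Σℚ (codewords D) (λ v →
    1/n! ℚ.* Σℚ (Sym n) (λ σ → monomial x (biComposition (u ^σ σ) v))))
    ≡⟨ ℚΣ.Σ-cong (codewords C) (λ u → ℚΣ.Σ-cong (codewords D) (average-pair u)) ⟩
  Σℚ (codewords C) (λ u → Σℚ (codewords D) (λ v → Σℚ BC (λ e → contribution e u v)))
    ≡⟨ RHS-expansion C D ⟨
  RHS C D x ∎
  where
  open ≡-Reasoning
  open Assembly {M} {n} x
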